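{- Let $\kappa^-,\kappa^+$ be partitions, $\ell^-=\ell(\kappa^-)$, $\ell^+=\ell(\kappa^+)$. Let $\omega$ be an $(\ell^-+1,\ell^+)$-large partition and let $\lambda\trianglelefteq_{\ell^- }\omega$ in the $\ell^-$-twisted dominance order. For each $M\in\mathbb{N}_0$ the map $f(\sigma)=\sigma\oplus(\kappa^-,\kappa^+)$ is an injective map of twisted intervals \[[\lambda\oplus M(\kappa^-,\kappa^+),\,\omega\oplus M(\kappa^-,\kappa^+)]_{\ell^- }\hookrightarrow[\lambda\oplus(M+1)(\kappa^-,\kappa^+),\,\omega\oplus(M+1)(\kappa^-,\kappa^+)]_{\ell^- },\] and it is bijective provided $M\ge L$, where $L$ is the maximum of (1) $\mathrm{L}([\lambda^-,\omega^-]^{(\ell^-)},\kappa^-)$; (2) $\mathrm{L}([\lambda^+,\omega^++(|\lambda^+|-|\omega^+|)]_{\trianglelefteq},\kappa^+)$; (3) $(\omega^+_1+\omega^+_2-2\lambda^+_1+2|\lambda^+|-2|\omega^+|)/(\kappa^+_1-\kappa^+_2)$; (4) $(\max(\ell(\lambda^+),\ell^+)+|\omega^-|-|\lambda^-|-\omega^-_{\ell^- })/\kappa^-_{\ell^- }$, where (3) is omitted if $\kappa^+_1=\kappa^+_2$ and (4) is omitted if $\kappa^-=\varnothing$; here $(\lambda^-,\lambda^+)$ and $(\omega^-,\omega^+)$ are the $\ell^-$-decompositions.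
   Context: Partitions are sequences with trailing zeros; $\ell(\cdot)$ number of nonzero parts; $'$ conjugate; sums componentwise; $\omega^++(c)$ adds $c$ to the first part; $\alpha\sqcup\beta$ is the partition with the union of the multisets of nonzero parts. For partitions $\gamma,\delta$, $\lambda\oplus(\gamma,\delta)=(\lambda+\delta)\sqcup\gamma'$ and $\lambda\oplus M(\gamma,\delta)=\lambda\oplus(M\gamma,M\delta)$. A partition $\sigma$ is $(a,b)$-large if $a=0$ or $b=0$ or $\sigma_b\ge a$. The $\ell$-decomposition of $\sigma$ is $\sigma^-=(\sigma'_1,\dots,\sigma'_\ell)$, $\sigma^+=\sigma-(\sigma^-)'$. The $\ell$-twisted dominance order on partitions of the same size: $\pi\trianglelefteq_\ell\sigma$ iff every partial sum of $(\pi^-_1,\dots,\pi^-_\ell,\pi^+_1,\pi^+_2,\dots)$ is at most the corresponding partial sum of $(\sigma^-_1,\dots,\sigma^-_\ell,\sigma^+_1,\dots)$; $[\gamma,\delta]_\ell=\{\sigma\text{ partition of }|\gamma|:\gamma\trianglelefteq_\ell\sigma\trianglelefteq_\ell\delta\}$. Bound L: for partitions $\lambda,\omega$ and non-empty $\kappa$, $\ell=\ell(\kappa)$, $1\le k\le\ell$: $L_k=(2\sum_{i<k}\omega_i+\omega_k+\omega_{k+1}-2\sum_{i\le k}\lambda_i)/(\kappa_k-\kappa_{k+1})$ if $\kappa_k>\kappa_{k+1}$, $L_k=0$ otherwise. If all have at most $p$ parts: $\mathrm{L}([\lambda,\omega]^{(p)},\kappa)=\max(L_1..L_\ell)$ if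 $p>\ell$, $=\max(L_1,\dots,L_{\ell-1},(|\omega|-|\lambda|-\omega_\ell)/\kappa_\ell)$ if $p=\ell$; $\mathrm{L}([\lambda,\omega]_\trianglelefteq,\kappa)=\max(L_1,\dots,L_\ell)$; $\mathrm{L}(\cdot,\varnothing)=0$. -}

module Defs where

open import Data.Nat as ℕ using (ℕ; zero; suc; _+_; _*_; _∸_; _≤_; _<_; _≤ᵇ_)
open import Data.Nat.Properties using (_≟_)
open import Data.Integer as ℤ using (ℤ; +_)
open import Data.Rational as ℚ using (ℚ; 0ℚ; _⊔_)
open import Data.List using (List; []; _∷_; length; map; filter; _++_; foldr)
open import Data.List.Relation.Unary.All using (All)
open import Data.List.Relation.Unary.Linked using (Linked)
open import Data.Bool using (Bool; true; false; if_then_else_)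
open import Data.Product using (_×_; Σ; ∃; _,_)
open import Data.Sum using (_⊎_)
open import Relation.Binary.PropositionalEquality using (_≡_)
open import Relation.Nullary using (yes; no)
open import Data.Nat.ListAction using (sum)

-- Partitions: canonical representation as weakly decreasing lists of
-- positive parts (the nonzero parts; trailing zeros implicit).

IsPartition : List ℕ → Set
IsPartition σ = Linked ℕ._≥_ σ × All (0 <_) σ

at : List ℕ → ℕ → ℕ
at []       _       = 0
at (x ∷ xs) zero    = x
at (x ∷ xs) (suc i) = at xs i

-- 1-based part σ_k (σ_0 := 0, never used)
part : List ℕ → ℕ → ℕ
part σ zero    = 0
part σ (suc k) = at σ k

oneTo : ℕ → List ℕ
oneTo zero    = []
oneTo (suc n) = oneTo n ++ (suc n ∷ [])

len : List ℕ → ℕ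
len σ = length (filter (λ x → 1 ℕ.≤? x) σ)

size : List ℕ → ℕ
size = sum

countGE : ℕ → List ℕ → ℕ
countGE j []       = 0
countGE j (x ∷ xs) = (if j ≤ᵇ x then 1 else 0) + countGE j xs

maxPart : List ℕ → ℕ
maxPart = foldr ℕ._⊔_ 0

conj : List ℕ → List ℕ
conj σ = map (λ j → countGE j σ) (oneTo (maxPart σ))

_+ₚ_ : List ℕ → List ℕ → List ℕ
[]       +ₚ ys       = ys
(x ∷ xs) +ₚ []       = x ∷ xs
(x ∷ xs) +ₚ (y ∷ ys) = (x + y) ∷ (xs +ₚ ys)

_-ₚ_ : List ℕ → List ℕ → List ℕ
[]       -ₚ ys       = []
(x ∷ xs) -ₚ []       = x ∷ xs
(x ∷ xs) -ₚ (y ∷ ys) = (x ∸ y) ∷ (xs -ₚ ys)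

nonzero : List ℕ → List ℕ
nonzero = filter (λ x → 1 ℕ.≤? x)

insertDesc : ℕ → List ℕ → List ℕ
insertDesc x []       = x ∷ []
insertDesc x (y ∷ ys) = if y ≤ᵇ x then x ∷ y ∷ ys else y ∷ insertDesc x ys

sortDesc : List ℕ → List ℕ
sortDesc = foldr insertDesc []

_⊔ₚ_ : List ℕ → List ℕ → List ℕ
α ⊔ₚ β = sortDesc (nonzero (α ++ β))

scale : ℕ → List ℕ → List ℕ
scale M = map (M *_)

oplus : List ℕ → List ℕ → List ℕ → List ℕ
oplus σ γ δ = (σ +ₚ δ) ⊔ₚ conj γ

oplusM : List ℕ → ℕ → List ℕ → List ℕ → List ℕ
oplusM σ M γ δ = oplus σ (scale M γ) (scale M δ)

Large : ℕ → ℕ → List ℕ → Set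
Large a b σ = (a ≡ 0) ⊎ (b ≡ 0) ⊎ (a ≤ part σ b)

decMinus : ℕ → List ℕ → List ℕ
decMinus ℓ σ = map (part (conj σ)) (oneTo ℓ)

decPlus : ℕ → List ℕ → List ℕ
decPlus ℓ σ = nonzero (σ -ₚ conj (decMinus ℓ σ))

twSeq : ℕ → List ℕ → ℕ → ℕ
twSeq ℓ σ i with i ℕ.<? ℓ
... | yes _ = part (decMinus ℓ σ) (suc i)
... | no  _ = part (decPlus ℓ σ) (suc (i ∸ ℓ))

psum : (ℕ → ℕ) → ℕ → ℕ
psum f zero    = 0
psum f (suc n) = psum f n + f n

TwLeq : ℕ → List ℕ → List ℕ → Set
TwLeq ℓ π σ = (size π ≡ size σ) × (∀ n → psum (twSeq ℓ π) n ≤ psum (twSeq ℓ σ) n)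

InTwInterval : ℕ → List ℕ → List ℕ → List ℕ → Set
InTwInterval ℓ γ δ σ = IsPartition σ × (size σ ≡ size γ) × TwLeq ℓ γ σ × TwLeq ℓ σ δ

-- a / d, with the value 0 when d = 0 (only used for the L_k = 0 convention
-- when κ_k = κ_{k+1}; all other denominators are positive)
frac : ℤ → ℕ → ℚ
frac a zero    = 0ℚ
frac a (suc d) = a ℚ./ suc d

-- max of a list; the empty list gives 0 (convention L(·,∅) = 0)
maxList : List ℚ → ℚ
maxList []       = 0ℚ
maxList (x ∷ xs) = foldr _⊔_ x xs

S : (ℕ → ℤ) → ℕ → ℤ
S f zero    = + 0
S f (suc n) = S f n ℤ.+ f (suc n)

toZ : List ℕ → ℕ → ℤ
toZ σ k = + part σ k

Lk : (ω lam : ℕ → ℤ) → List ℕ → ℕ → ℚ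
Lk ω lam κ k =
  frac ((+ 2) ℤ.* S ω (k ∸ 1) ℤ.+ ω k ℤ.+ ω (suc k) ℤ.- (+ 2) ℤ.* S lam k)
       (part κ k ∸ part κ (suc k))

LDom : (lam ω : ℕ → ℤ) → List ℕ → ℚ
LDom lam ω κ = maxList (map (Lk ω lam κ) (oneTo (len κ)))

-- L([λ,ω]^{(p)}, κ) for λ, ω, κ with at most p parts (so p ≥ ℓ(κ)):
-- p > ℓ : max(L_1,…,L_ℓ);  p = ℓ : max(L_1,…,L_{ℓ-1}, (|ω|-|λ|-ω_ℓ)/κ_ℓ)
LBox : ℕ → (lam ω : List ℕ) → List ℕ → ℚ
LBox p lam ω κ with len κ
... | zero  = 0ℚ
... | suc m with suc m ℕ.<? p
...   | yes _ = maxList (map (Lk (toZ ω) (toZ lam) κ) (oneTo (suc m)))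
...   | no  _ =
        maxList (map (Lk (toZ ω) (toZ lam) κ) (oneTo m)
                 ++ (frac (+ size ω ℤ.- + size lam ℤ.- + part ω (suc m)) (part κ (suc m)) ∷ []))

LBound : (κm κp lam ω : List ℕ) → ℚ
LBound κm κp lam ω =
  maxList (term1 ∷ term2 ∷ term3 ++ term4)
  where
    ℓm = len κm
    ℓp = len κp
    lm = decMinus ℓm lam
    lp = decPlus  ℓm lam
    om = decMinus ℓm ω
    op = decPlus  ℓm ω
    c : ℤ
    c = + size lp ℤ.- + size op
    opc : ℕ → ℤ
    opc k with k ≟ 1
    ... | yes _ = toZ op k ℤ.+ c
    ... | no  _ = toZ op k
    term1 = LBox ℓm lm om κm
    term2 = LDom (toZ lp) opc κp
    term3 : List ℚ
    term3 with part κp 1 ≟ part κp 2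
    ... | yes _ = []
    ... | no  _ =
          frac (toZ op 1 ℤ.+ toZ op 2 ℤ.- (+ 2) ℤ.* toZ lp 1
                ℤ.+ (+ 2) ℤ.* (+ size lp) ℤ.- (+ 2) ℤ.* (+ size op))
               (part κp 1 ∸ part κp 2) ∷ []
    term4 : List ℚ
    term4 with ℓm ≟ 0
    ... | yes _ = []
    ... | no  _ =
          frac (+ (len lp ℕ.⊔ ℓp) ℤ.+ + size om ℤ.- + size lm ℤ.- + part om ℓm)
               (part κm ℓm) ∷ []

-- An ℓ-decomposition (σ⁻ , σ⁺) is recorded by the twisted sequence twSeq ℓ σ = (σ⁻₁,…,σ⁻_ℓ,σ⁺₁,σ⁺₂,…),
-- which determines σ, and the twisted order compares partial sums of twisted sequences.
-- On partitions with at least ℓ columns in the first ℓ(κ⁺) rows (everything below ω ⊕ M(κ⁻,κ⁺),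
-- by largeness of ω) the map σ ↦ σ ⊕ (κ⁻ , κ⁺) adds the fixed sequence κ̂ = (κ⁻₁,…,κ⁻_ℓ,κ⁺₁,κ⁺₂,…)
-- to the twisted sequence. So it shifts all partial sums in step with the interval ends: it maps
-- the interval at M into the one at M + 1 and is injective.
-- Conversely the partial sums of a partition ρ of the interval at M + 1 are squeezed between
-- those of λ and ω plus M + 1 times those of κ̂. Comparing the bounds at three consecutive
-- indices shows that, once M ≥ L, twSeq ρ - κ̂ is nonnegative, weakly decreasing in each block,
-- compatible at the junction of the blocks and finitely supported; such a sequence is the
-- twisted sequence of a partition, the preimage of ρ.

module Submission where

open import Defs
open import Data.Nat as ℕ using (ℕ; zero; suc; _+_; _*_; _∸_; _≤_; _<_; _≤ᵇ_; z≤n; s≤s; _⊓_; _⊔_)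
open import Data.Nat.Properties
open import Data.Nat.ListAction using (sum)
open import Data.List using (List; []; _∷_; length; map; _++_; foldr)
import Data.List.Properties as List
open import Data.List.Relation.Unary.All using (All; []; _∷_)
open import Data.List.Relation.Unary.Linked using (Linked; []; [-]; _∷_)
open import Data.List.Relation.Unary.Any using (here; there)
open import Data.List.Membership.Propositional using (_∈_)
open import Data.List.Membership.Propositional.Properties using (∈-++⁺ˡ; ∈-++⁺ʳ; ∈-map⁺)
open import Data.Bool using (true; false; if_then_else_; T)
open import Data.Unit using (tt)
open import Data.Integer as ℤ using (ℤ)
import Data.Integer.Properties as ℤP
open import Data.Integer.GCD using (gcd)
import Data.Integer.Tactic.RingSolver as ZSolver
open import Data.Rational as ℚ using (ℚ; ↥_; ↧_)
import Data.Rational.Properties as ℚP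
open import Data.Product using (_×_; ∃; _,_; proj₁; proj₂)
open import Data.Sum using (inj₁; inj₂)
open import Data.Empty using (⊥-elim)
open import Relation.Binary.PropositionalEquality
open import Relation.Nullary using (yes; no; ¬_)
open import Function using (_∘_)
open import Algebra.Properties.CommutativeSemigroup +-commutativeSemigroup
  using () renaming (interchange to +-interchange; x∙yz≈y∙xz to +-left-comm; xy∙z≈xz∙y to +-right-comm)

suc[n∸1]≡n : ∀ {n} → 0 < n → suc (n ∸ 1) ≡ n
suc[n∸1]≡n {suc n} _ = refl

n∸1<n : ∀ {n} → 0 < n → n ∸ 1 < n
n∸1<n {suc n} _ = ≤-refl

<⇒≤∸1 : ∀ {m n} → m < n → m ≤ n ∸ 1
<⇒≤∸1 {n = suc n} (s≤s m≤n) = m≤n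

≡-by-< : ∀ {a b} → (∀ t → t < a → t < b) → (∀ t → t < b → t < a) → a ≡ b
≡-by-< {a} {b} a⊆b b⊆a = ≤-antisym (≮⇒≥ λ b<a → n≮n b (a⊆b b b<a)) (≮⇒≥ λ a<b → n≮n a (b⊆a a a<b))

+<⇒<∸ : ∀ ℓ {s x} → ℓ + s < x → s < x ∸ ℓ
+<⇒<∸ ℓ {s} {x} ℓ+s<x = m+n≤o⇒m≤o∸n (suc s) (subst (_≤ x) (cong suc (+-comm ℓ s)) ℓ+s<x)

<∸⇒+< : ∀ ℓ {s x} → s < x ∸ ℓ → ℓ + s < x
<∸⇒+< ℓ {s} {x} s<x∸ℓ =
  subst (_≤ x) (cong suc (+-comm s ℓ)) (m≤o∸n⇒m+n≤o (suc s) (<⇒≤ ℓ<x) s<x∸ℓ)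
  where
  ℓ<x : ℓ < x
  ℓ<x = m∸n≢0⇒n<m λ x∸ℓ≡0 → <⇒≢ (≤-trans (s≤s z≤n) s<x∸ℓ) (sym x∸ℓ≡0)

split-at : ∀ {P : ℕ → Set} ℓ → (∀ {i} → i < ℓ → P i) → (∀ {i} → ℓ ≤ i → P i) → ∀ i → P i
split-at ℓ below above i with i ℕ.<? ℓ
... | yes i<ℓ = below i<ℓ
... | no  i≮ℓ = above (≮⇒≥ i≮ℓ)

record Antitone (xs : List ℕ) : Set where
  constructor mkAntitone
  field antitone : ∀ i → at xs (suc i) ≤ at xs i
open Antitone public

antitone-tail : ∀ {x xs} → Antitone (x ∷ xs) → Antitone xs
antitone-tail a = mkAntitone (λ i → antitone a (suc i))

antitone-mono : ∀ {xs} → Antitone xs → ∀ {i j} → i ≤ j → at xs j ≤ at xs i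
antitone-mono {xs} a {i} {j} i≤j with m≤n⇒∃[o]m+o≡n i≤j
... | o , refl = go o
  where
  go : ∀ o → at xs (i + o) ≤ at xs i
  go zero    = ≤-reflexive (cong (at xs) (+-identityʳ i))
  go (suc o) = ≤-trans (≤-reflexive (cong (at xs) (+-suc i o))) (≤-trans (antitone a (i + o)) (go o))

linked⇒antitone : ∀ {xs} → Linked ℕ._≥_ xs → Antitone xs
linked⇒antitone l = mkAntitone (go l)
  where
  go : ∀ {xs} → Linked ℕ._≥_ xs → ∀ i → at xs (suc i) ≤ at xs i
  go []      i       = z≤n
  go [-]     i       = z≤n
  go (p ∷ l) zero    = p
  go (p ∷ l) (suc i) = go l i

antitone⇒linked : ∀ {xs} → Antitone xs → Linked ℕ._≥_ xs
antitone⇒linked {[]}         a = []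
antitone⇒linked {x ∷ []}     a = [-]
antitone⇒linked {x ∷ y ∷ xs} a = antitone a 0 ∷ antitone⇒linked (antitone-tail a)

partition⇒antitone : ∀ {σ} → IsPartition σ → Antitone σ
partition⇒antitone (l , _) = linked⇒antitone l

at-≥length : ∀ xs {i} → length xs ≤ i → at xs i ≡ 0
at-≥length []       _         = refl
at-≥length (x ∷ xs) (s≤s len≤i) = at-≥length xs len≤i

0<at⇒<length : ∀ xs {i} → 0 < at xs i → i < length xs
0<at⇒<length xs {i} 0<xᵢ = ≰⇒> λ len≤i → <⇒≢ 0<xᵢ (sym (at-≥length xs len≤i))

at-<length⇒0< : ∀ {xs} → All (0 <_) xs → ∀ {i} → i < length xs → 0 < at xs i
at-<length⇒0< (p ∷ _)  {zero}  _           = p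
at-<length⇒0< (_ ∷ ps) {suc i} (s≤s i<len) = at-<length⇒0< ps i<len

at-injective : ∀ {xs ys} → All (0 <_) xs → All (0 <_) ys → (∀ i → at xs i ≡ at ys i) → xs ≡ ys
at-injective {[]}     {[]}     _        _        _ = refl
at-injective {[]}     {y ∷ ys} _        (py ∷ _) e = ⊥-elim (<⇒≢ py (e 0))
at-injective {x ∷ xs} {[]}     (px ∷ _) _        e = ⊥-elim (<⇒≢ px (sym (e 0)))
at-injective {x ∷ xs} {y ∷ ys} (_ ∷ px) (_ ∷ py) e = cong₂ _∷_ (e 0) (at-injective px py (e ∘ suc))

at-++ˡ : ∀ xs ys {i} → i < length xs → at (xs ++ ys) i ≡ at xs i
at-++ˡ (x ∷ xs) ys {zero}  _           = refl
at-++ˡ (x ∷ xs) ys {suc i} (s≤s i<len) = at-++ˡ xs ys i<len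

at-++ʳ : ∀ xs ys i → at (xs ++ ys) (length xs + i) ≡ at ys i
at-++ʳ []       ys i = refl
at-++ʳ (x ∷ xs) ys i = at-++ʳ xs ys i

length-map-oneTo : ∀ (g : ℕ → ℕ) n → length (map g (oneTo n)) ≡ n
length-map-oneTo g zero    = refl
length-map-oneTo g (suc n) = begin
  length (map g (oneTo n ++ suc n ∷ []))     ≡⟨ cong length (List.map-++ g (oneTo n) _) ⟩
  length (map g (oneTo n) ++ g (suc n) ∷ []) ≡⟨ List.length-++ (map g (oneTo n)) ⟩
  length (map g (oneTo n)) + 1               ≡⟨ cong (_+ 1) (length-map-oneTo g n) ⟩
  n + 1                                      ≡⟨ +-comm n 1 ⟩
  suc n                                      ∎
  where open ≡-Reasoning

at-map-oneTo-< : ∀ (g : ℕ → ℕ) n {i} → i < n → at (map g (oneTo n)) i ≡ g (suc i)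
at-map-oneTo-< g (suc n) {i} i<1+n rewrite List.map-++ g (oneTo n) (suc n ∷ []) with m≤n⇒m<n∨m≡n (≤-pred i<1+n)
... | inj₁ i<n = trans (at-++ˡ (map g (oneTo n)) _ (subst (i <_) (sym (length-map-oneTo g n)) i<n))
                       (at-map-oneTo-< g n i<n)
... | inj₂ refl = trans (cong (at (map g (oneTo i) ++ g (suc i) ∷ []))
                              (trans (sym (+-identityʳ i)) (cong (_+ 0) (sym (length-map-oneTo g i)))))
                        (at-++ʳ (map g (oneTo i)) _ 0)

at-map-oneTo-≥ : ∀ (g : ℕ → ℕ) n {i} → n ≤ i → at (map g (oneTo n)) i ≡ 0
at-map-oneTo-≥ g n n≤i = at-≥length (map g (oneTo n)) (subst (_≤ _) (sym (length-map-oneTo g n)) n≤i)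

at-+ₚ : ∀ xs ys i → at (xs +ₚ ys) i ≡ at xs i + at ys i
at-+ₚ []       ys       i       = refl
at-+ₚ (x ∷ xs) []       zero    = sym (+-identityʳ x)
at-+ₚ (x ∷ xs) []       (suc i) = sym (+-identityʳ _)
at-+ₚ (x ∷ xs) (y ∷ ys) zero    = refl
at-+ₚ (x ∷ xs) (y ∷ ys) (suc i) = at-+ₚ xs ys i

at-minusₚ : ∀ xs ys i → at (xs -ₚ ys) i ≡ at xs i ∸ at ys i
at-minusₚ []       ys       i       = sym (0∸n≡0 (at ys i))
at-minusₚ (x ∷ xs) []       zero    = refl
at-minusₚ (x ∷ xs) []       (suc i) = refl
at-minusₚ (x ∷ xs) (y ∷ ys) zero    = refl
at-minusₚ (x ∷ xs) (y ∷ ys) (suc i) = at-minusₚ xs ys i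

at-scale : ∀ M xs i → at (scale M xs) i ≡ M * at xs i
at-scale M []       i       = sym (*-zeroʳ M)
at-scale M (x ∷ xs) zero    = refl
at-scale M (x ∷ xs) (suc i) = at-scale M xs i

antitone-via : ∀ {ys} (f : ℕ → ℕ) → (∀ i → at ys i ≡ f i) → (∀ i → f (suc i) ≤ f i) → Antitone ys
antitone-via f e f-anti = mkAntitone (λ i → subst₂ _≤_ (sym (e (suc i))) (sym (e i)) (f-anti i))

+ₚ-antitone : ∀ {xs ys} → Antitone xs → Antitone ys → Antitone (xs +ₚ ys)
+ₚ-antitone {xs} {ys} a b = antitone-via _ (at-+ₚ xs ys) (λ i → +-mono-≤ (antitone a i) (antitone b i))

scale-antitone : ∀ M {xs} → Antitone xs → Antitone (scale M xs)
scale-antitone M {xs} a = antitone-via _ (at-scale M xs) (λ i → *-monoʳ-≤ M (antitone a i))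

-- Column lengths: countGE j σ is σ′ⱼ

≤ᵇ≡true⇒≤ : ∀ {j x} → (j ≤ᵇ x) ≡ true → j ≤ x
≤ᵇ≡true⇒≤ {j} {x} e = ≤ᵇ⇒≤ j x (subst T (sym e) tt)

≤ᵇ≡false⇒> : ∀ {j x} → (j ≤ᵇ x) ≡ false → x < j
≤ᵇ≡false⇒> e = ≰⇒> (λ j≤x → subst T e (≤⇒≤ᵇ j≤x))

countGE-≤-length : ∀ j xs → countGE j xs ≤ length xs
countGE-≤-length j []       = z≤n
countGE-≤-length j (x ∷ xs) with j ≤ᵇ x
... | true  = s≤s (countGE-≤-length j xs)
... | false = m≤n⇒m≤1+n (countGE-≤-length j xs)

countGE-antitone : ∀ {j j'} xs → j ≤ j' → countGE j' xs ≤ countGE j xs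
countGE-antitone []                 _    = z≤n
countGE-antitone {j} {j'} (x ∷ xs) j≤j' with j' ≤ᵇ x in e' | j ≤ᵇ x in e
... | true  | true  = s≤s (countGE-antitone xs j≤j')
... | true  | false = ⊥-elim (<⇒≱ (≤ᵇ≡false⇒> e) (≤-trans j≤j' (≤ᵇ≡true⇒≤ e')))
... | false | true  = m≤n⇒m≤1+n (countGE-antitone xs j≤j')
... | false | false = countGE-antitone xs j≤j'

countGE-all< : ∀ j xs → (∀ i → at xs i ≤ j) → countGE (suc j) xs ≡ 0
countGE-all< j []       _ = refl
countGE-all< j (x ∷ xs) small with suc j ≤ᵇ x in e
... | true  = ⊥-elim (<⇒≱ (s≤s (small 0)) (≤ᵇ≡true⇒≤ e))
... | false = countGE-all< j xs (small ∘ suc)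

<at⇒<countGE : ∀ {xs} → Antitone xs → ∀ i j → j < at xs i → i < countGE (suc j) xs
<at⇒<countGE {x ∷ xs} a i j j<xᵢ with suc j ≤ᵇ x in e
<at⇒<countGE {x ∷ xs} a zero    j j<xᵢ | true  = s≤s z≤n
<at⇒<countGE {x ∷ xs} a (suc i) j j<xᵢ | true  = s≤s (<at⇒<countGE (antitone-tail a) i j j<xᵢ)
... | false = ⊥-elim (<⇒≱ (≤ᵇ≡false⇒> e) (≤-trans j<xᵢ (antitone-mono a (z≤n {i}))))

<countGE⇒<at : ∀ {xs} → Antitone xs → ∀ i j → i < countGE (suc j) xs → j < at xs i
<countGE⇒<at {x ∷ xs} a i j i<c with suc j ≤ᵇ x in e
<countGE⇒<at {x ∷ xs} a zero    j _         | true = ≤ᵇ≡true⇒≤ e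
<countGE⇒<at {x ∷ xs} a (suc i) j (s≤s i<c) | true = <countGE⇒<at (antitone-tail a) i j i<c
... | false rewrite countGE-all< j xs (λ k → ≤-pred (≤-trans (s≤s (antitone-mono a (z≤n {suc k}))) (≤ᵇ≡false⇒> e)))
  with i<c
... | ()

countGE-++ : ∀ j xs ys → countGE j (xs ++ ys) ≡ countGE j xs + countGE j ys
countGE-++ j []       ys = refl
countGE-++ j (x ∷ xs) ys =
  trans (cong ((if j ≤ᵇ x then 1 else 0) +_) (countGE-++ j xs ys)) (sym (+-assoc (if j ≤ᵇ x then 1 else 0) _ _))

countGE-nonzero : ∀ j xs → countGE (suc j) (nonzero xs) ≡ countGE (suc j) xs
countGE-nonzero j []           = refl
countGE-nonzero j (zero ∷ xs)  = countGE-nonzero j xs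
countGE-nonzero j (suc x ∷ xs) = cong ((if suc j ≤ᵇ suc x then 1 else 0) +_) (countGE-nonzero j xs)

countGE-insertDesc : ∀ j x ys → countGE j (insertDesc x ys) ≡ countGE j (x ∷ ys)
countGE-insertDesc j x []       = refl
countGE-insertDesc j x (y ∷ ys) with y ≤ᵇ x
... | true  = refl
... | false = trans (cong ((if j ≤ᵇ y then 1 else 0) +_) (countGE-insertDesc j x ys))
                    (+-left-comm (if j ≤ᵇ y then 1 else 0) (if j ≤ᵇ x then 1 else 0) (countGE j ys))

countGE-sortDesc : ∀ j xs → countGE j (sortDesc xs) ≡ countGE j xs
countGE-sortDesc j []       = refl
countGE-sortDesc j (x ∷ xs) = trans (countGE-insertDesc j x (sortDesc xs)) (cong ((if j ≤ᵇ x then 1 else 0) +_) (countGE-sortDesc j xs))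

at-≤-maxPart : ∀ xs i → at xs i ≤ maxPart xs
at-≤-maxPart []       i       = z≤n
at-≤-maxPart (x ∷ xs) zero    = m≤m⊔n x _
at-≤-maxPart (x ∷ xs) (suc i) = ≤-trans (at-≤-maxPart xs i) (m≤n⊔m x _)

at-conj : ∀ σ i → at (conj σ) i ≡ countGE (suc i) σ
at-conj σ i with i ℕ.<? maxPart σ
... | yes i<max = at-map-oneTo-< (λ j → countGE j σ) (maxPart σ) i<max
... | no  i≮max = trans (at-map-oneTo-≥ (λ j → countGE j σ) (maxPart σ) (≮⇒≥ i≮max))
                        (sym (countGE-all< i σ (λ k → ≤-trans (at-≤-maxPart σ k) (≮⇒≥ i≮max))))

countGE-map-oneTo : ∀ (g : ℕ → ℕ) n j t → (∀ i → i < n → (j < g (suc i) → i < t) × (i < t → j < g (suc i)))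
                  → countGE (suc j) (map g (oneTo n)) ≡ n ⊓ t
countGE-map-oneTo g zero    j t _ = refl
countGE-map-oneTo g (suc n) j t threshold = begin
  countGE (suc j) (map g (oneTo n ++ suc n ∷ []))
    ≡⟨ cong (countGE (suc j)) (List.map-++ g (oneTo n) _) ⟩
  countGE (suc j) (map g (oneTo n) ++ g (suc n) ∷ [])
    ≡⟨ countGE-++ (suc j) (map g (oneTo n)) _ ⟩
  countGE (suc j) (map g (oneTo n)) + countGE (suc j) (g (suc n) ∷ [])
    ≡⟨ cong (_+ _) (countGE-map-oneTo g n j t (λ i i<n → threshold i (m<n⇒m<1+n i<n))) ⟩
  n ⊓ t + countGE (suc j) (g (suc n) ∷ [])
    ≡⟨ last ⟩
  suc n ⊓ t ∎
  where
  open ≡-Reasoning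
  last : n ⊓ t + countGE (suc j) (g (suc n) ∷ []) ≡ suc n ⊓ t
  last with suc j ≤ᵇ g (suc n) in e
  ... | true  = let n<t = proj₁ (threshold n ≤-refl) (≤ᵇ≡true⇒≤ e) in
                trans (cong (_+ 1) (m≤n⇒m⊓n≡m (<⇒≤ n<t))) (trans (+-comm n 1) (sym (m≤n⇒m⊓n≡m n<t)))
  ... | false with n ℕ.<? t
  ...   | yes n<t = ⊥-elim (<⇒≱ (≤ᵇ≡false⇒> e) (proj₂ (threshold n ≤-refl) n<t))
  ...   | no  n≮t = trans (+-identityʳ _)
                       (trans (m≥n⇒m⊓n≡n (≮⇒≥ n≮t)) (sym (m≥n⇒m⊓n≡n (m≤n⇒m≤1+n (≮⇒≥ n≮t)))))

countGE-conj : ∀ {γ} → Antitone γ → ∀ j → countGE (suc j) (conj γ) ≡ at γ j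
countGE-conj {γ} a j =
  trans (countGE-map-oneTo (λ i → countGE i γ) (maxPart γ) j (at γ j) (λ i _ → <countGE⇒<at a j i , <at⇒<countGE a j i))
        (m≥n⇒m⊓n≡n (at-≤-maxPart γ j))

countGE-decMinus : ∀ {σ} → Antitone σ → ∀ ℓ i → countGE (suc i) (decMinus ℓ σ) ≡ ℓ ⊓ at σ i
countGE-decMinus {σ} a ℓ i = countGE-map-oneTo (part (conj σ)) ℓ i (at σ i)
  (λ j _ → (λ i<σ'ⱼ → <countGE⇒<at a i j (subst (i <_) (at-conj σ j) i<σ'ⱼ)) ,
           (λ j<σᵢ → subst (i <_) (sym (at-conj σ j)) (<at⇒<countGE a i j j<σᵢ)))

nonzero-all0 : ∀ xs → (∀ i → at xs i ≡ 0) → nonzero xs ≡ []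
nonzero-all0 []           _   = refl
nonzero-all0 (zero ∷ xs)  xs≡0 = nonzero-all0 xs (xs≡0 ∘ suc)
nonzero-all0 (suc x ∷ xs) xs≡0 with xs≡0 0
... | ()

at-nonzero : ∀ {xs} → Antitone xs → ∀ i → at (nonzero xs) i ≡ at xs i
at-nonzero {[]}         a i = refl
at-nonzero {zero ∷ xs}  a i
  rewrite nonzero-all0 xs (λ k → n≤0⇒n≡0 (antitone-mono a (z≤n {suc k}))) = sym (n≤0⇒n≡0 (antitone-mono a (z≤n {i})))
at-nonzero {suc x ∷ xs} a zero    = refl
at-nonzero {suc x ∷ xs} a (suc i) = at-nonzero (antitone-tail a) i

nonzero-positive : ∀ xs → All (0 <_) (nonzero xs)
nonzero-positive []           = []
nonzero-positive (zero ∷ xs)  = nonzero-positive xs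
nonzero-positive (suc x ∷ xs) = s≤s z≤n ∷ nonzero-positive xs

nonzero-antitone : ∀ {xs} → Antitone xs → Antitone (nonzero xs)
nonzero-antitone {xs} a = antitone-via (at xs) (at-nonzero a) (antitone a)

nonzero-positive-id : ∀ {xs} → All (0 <_) xs → nonzero xs ≡ xs
nonzero-positive-id {[]}         _       = refl
nonzero-positive-id {suc x ∷ xs} (_ ∷ p) = cong (suc x ∷_) (nonzero-positive-id p)

length-nonzero : ∀ xs → length (nonzero xs) ≤ length xs
length-nonzero []           = z≤n
length-nonzero (zero ∷ xs)  = m≤n⇒m≤1+n (length-nonzero xs)
length-nonzero (suc x ∷ xs) = s≤s (length-nonzero xs)

len≡length : ∀ {σ} → All (0 <_) σ → len σ ≡ length σ
len≡length p = cong length (nonzero-positive-id p)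

insertDesc-linked : ∀ x ys → Linked ℕ._≥_ ys → Linked ℕ._≥_ (insertDesc x ys)
insertDesc-linked x []       _ = [-]
insertDesc-linked x (y ∷ ys) l with y ≤ᵇ x in e
... | true  = ≤ᵇ≡true⇒≤ e ∷ l
... | false = go x ys (<⇒≤ (≤ᵇ≡false⇒> e)) l
  where
  go : ∀ {z} x ys → x ≤ z → Linked ℕ._≥_ (z ∷ ys) → Linked ℕ._≥_ (z ∷ insertDesc x ys)
  go x []       x≤z _ = x≤z ∷ [-]
  go x (y ∷ ys) x≤z (y≤z ∷ l) with y ≤ᵇ x in e
  ... | true  = x≤z ∷ (≤ᵇ≡true⇒≤ e ∷ l)
  ... | false = y≤z ∷ go x ys (<⇒≤ (≤ᵇ≡false⇒> e)) l

sortDesc-linked : ∀ xs → Linked ℕ._≥_ (sortDesc xs)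
sortDesc-linked []       = []
sortDesc-linked (x ∷ xs) = insertDesc-linked x (sortDesc xs) (sortDesc-linked xs)

insertDesc-all : ∀ {P : ℕ → Set} x ys → P x → All P ys → All P (insertDesc x ys)
insertDesc-all x []       px _          = px ∷ []
insertDesc-all x (y ∷ ys) px (py ∷ pys) with y ≤ᵇ x
... | true  = px ∷ py ∷ pys
... | false = py ∷ insertDesc-all x ys px pys

sortDesc-all : ∀ {P : ℕ → Set} xs → All P xs → All P (sortDesc xs)
sortDesc-all []       _          = []
sortDesc-all (x ∷ xs) (px ∷ pxs) = insertDesc-all x (sortDesc xs) px (sortDesc-all xs pxs)

oplus-isPartition : ∀ σ γ δ → IsPartition (oplus σ γ δ)
oplus-isPartition σ γ δ =
  sortDesc-linked (nonzero ((σ +ₚ δ) ++ conj γ)) , sortDesc-all _ (nonzero-positive ((σ +ₚ δ) ++ conj γ))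

oplus-antitone : ∀ σ γ δ → Antitone (oplus σ γ δ)
oplus-antitone σ γ δ = partition⇒antitone (oplus-isPartition σ γ δ)

countGE-oplus : ∀ σ γ δ j → countGE (suc j) (oplus σ γ δ) ≡ countGE (suc j) (σ +ₚ δ) + countGE (suc j) (conj γ)
countGE-oplus σ γ δ j = begin
  countGE (suc j) (sortDesc (nonzero ((σ +ₚ δ) ++ conj γ))) ≡⟨ countGE-sortDesc (suc j) (nonzero ((σ +ₚ δ) ++ conj γ)) ⟩
  countGE (suc j) (nonzero ((σ +ₚ δ) ++ conj γ))            ≡⟨ countGE-nonzero j ((σ +ₚ δ) ++ conj γ) ⟩
  countGE (suc j) ((σ +ₚ δ) ++ conj γ)                      ≡⟨ countGE-++ (suc j) (σ +ₚ δ) (conj γ) ⟩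
  countGE (suc j) (σ +ₚ δ) + countGE (suc j) (conj γ)       ∎
  where open ≡-Reasoning

-- The twisted sequence

twSeq-< : ∀ ℓ σ {i} → i < ℓ → twSeq ℓ σ i ≡ countGE (suc i) σ
twSeq-< ℓ σ {i} i<ℓ with i ℕ.<? ℓ
... | yes _   = trans (at-map-oneTo-< (part (conj σ)) ℓ i<ℓ) (at-conj σ i)
... | no  i≮ℓ = ⊥-elim (i≮ℓ i<ℓ)

at-decMinus : ∀ ℓ σ {i} → i < ℓ → at (decMinus ℓ σ) i ≡ twSeq ℓ σ i
at-decMinus ℓ σ {i} i<ℓ with i ℕ.<? ℓ
... | yes _   = refl
... | no  i≮ℓ = ⊥-elim (i≮ℓ i<ℓ)

at-decPlus : ∀ {σ} → Antitone σ → ∀ ℓ t → at (decPlus ℓ σ) t ≡ at σ t ∸ ℓ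
at-decPlus {σ} a ℓ t = trans (at-nonzero σ-σ⁻-antitone t) (at-σ-σ⁻ t)
  where
  at-σ-σ⁻ : ∀ t → at (σ -ₚ conj (decMinus ℓ σ)) t ≡ at σ t ∸ ℓ
  at-σ-σ⁻ t = begin
    at (σ -ₚ conj (decMinus ℓ σ)) t ≡⟨ at-minusₚ σ _ t ⟩
    at σ t ∸ at (conj (decMinus ℓ σ)) t ≡⟨ cong (at σ t ∸_) (trans (at-conj (decMinus ℓ σ) t) (countGE-decMinus a ℓ t)) ⟩
    at σ t ∸ (ℓ ⊓ at σ t)             ≡⟨ ∸-distribˡ-⊓-⊔ (at σ t) ℓ (at σ t) ⟩
    (at σ t ∸ ℓ) ⊔ (at σ t ∸ at σ t)  ≡⟨ cong ((at σ t ∸ ℓ) ⊔_) (n∸n≡0 (at σ t)) ⟩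
    (at σ t ∸ ℓ) ⊔ 0                  ≡⟨ ⊔-identityʳ _ ⟩
    at σ t ∸ ℓ                        ∎
    where open ≡-Reasoning
  σ-σ⁻-antitone : Antitone (σ -ₚ conj (decMinus ℓ σ))
  σ-σ⁻-antitone = antitone-via (λ t → at σ t ∸ ℓ) at-σ-σ⁻ (λ i → ∸-monoˡ-≤ ℓ (antitone a i))

twSeq-≥ : ∀ {σ} → Antitone σ → ∀ ℓ {i} → ℓ ≤ i → twSeq ℓ σ i ≡ at σ (i ∸ ℓ) ∸ ℓ
twSeq-≥ a ℓ {i} ℓ≤i with i ℕ.<? ℓ
... | yes i<ℓ = ⊥-elim (<⇒≱ i<ℓ ℓ≤i)
... | no  _   = at-decPlus a ℓ (i ∸ ℓ)

twSeq-+ : ∀ {σ} → Antitone σ → ∀ ℓ t → twSeq ℓ σ (ℓ + t) ≡ at σ t ∸ ℓ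
twSeq-+ {σ} a ℓ t = trans (twSeq-≥ a ℓ (m≤m+n ℓ t)) (cong (λ u → at σ u ∸ ℓ) (m+n∸m≡n ℓ t))

at-decPlus≡twSeq : ∀ {σ} → Antitone σ → ∀ ℓ t → at (decPlus ℓ σ) t ≡ twSeq ℓ σ (ℓ + t)
at-decPlus≡twSeq a ℓ t = trans (at-decPlus a ℓ t) (sym (twSeq-+ a ℓ t))

≡-by-countGE-above : ∀ {xs ys} → Antitone xs → Antitone ys → ∀ ℓ
  → (∀ s → countGE (suc (ℓ + s)) xs ≡ countGE (suc (ℓ + s)) ys) → ∀ t → at xs t ∸ ℓ ≡ at ys t ∸ ℓ
≡-by-countGE-above {xs} {ys} axs ays ℓ e t = ≡-by-< (transfer axs ays e) (transfer ays axs (sym ∘ e))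
  where
  transfer : ∀ {xs ys} → Antitone xs → Antitone ys → (∀ s → countGE (suc (ℓ + s)) xs ≡ countGE (suc (ℓ + s)) ys)
           → ∀ s → s < at xs t ∸ ℓ → s < at ys t ∸ ℓ
  transfer axs ays e s s<xₜ∸ℓ =
    +<⇒<∸ ℓ (<countGE⇒<at ays t (ℓ + s) (subst (t <_) (e s) (<at⇒<countGE axs t (ℓ + s) (<∸⇒+< ℓ s<xₜ∸ℓ))))

twPair : ℕ → List ℕ → List ℕ → ℕ → ℕ
twPair ℓ γ δ i with i ℕ.<? ℓ
... | yes _ = at γ i
... | no  _ = at δ (i ∸ ℓ)

twPair-< : ∀ ℓ γ δ {i} → i < ℓ → twPair ℓ γ δ i ≡ at γ i
twPair-< ℓ γ δ {i} i<ℓ with i ℕ.<? ℓ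
... | yes _   = refl
... | no  i≮ℓ = ⊥-elim (i≮ℓ i<ℓ)

twPair-≥ : ∀ ℓ γ δ {i} → ℓ ≤ i → twPair ℓ γ δ i ≡ at δ (i ∸ ℓ)
twPair-≥ ℓ γ δ {i} ℓ≤i with i ℕ.<? ℓ
... | yes i<ℓ = ⊥-elim (<⇒≱ i<ℓ ℓ≤i)
... | no  _   = refl

twPair-+ : ∀ ℓ γ δ t → twPair ℓ γ δ (ℓ + t) ≡ at δ t
twPair-+ ℓ γ δ t = trans (twPair-≥ ℓ γ δ (m≤m+n ℓ t)) (cong (at δ) (m+n∸m≡n ℓ t))

twPair-scale : ∀ ℓ M γ δ i → twPair ℓ (scale M γ) (scale M δ) i ≡ M * twPair ℓ γ δ i
twPair-scale ℓ M γ δ i with i ℕ.<? ℓ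
... | yes _ = at-scale M γ i
... | no  _ = at-scale M δ (i ∸ ℓ)

-- The ℓ-decomposition of σ ⊕ (γ , δ) is (σ⁻ + γ , σ⁺ + δ).
module _ (ℓ : ℕ) {σ γ δ : List ℕ} (aσ : Antitone σ) (aγ : Antitone γ) (aδ : Antitone δ)
         (γ-short : ∀ k → ℓ ≤ k → at γ k ≡ 0) (σ-wide : ∀ k → 0 < at δ k → ℓ ≤ at σ k) where

  private
    -- adding δ only lengthens rows that already have at least ℓ boxes
    countGE-σ+δ : ∀ {i} → i < ℓ → countGE (suc i) (σ +ₚ δ) ≡ countGE (suc i) σ
    countGE-σ+δ {i} i<ℓ = ≡-by-<
      (λ k k<c → <at⇒<countGE aσ k i (row k (<countGE⇒<at (+ₚ-antitone aσ aδ) k i k<c)))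
      (λ k k<c → <at⇒<countGE (+ₚ-antitone aσ aδ) k i
                   (subst (i <_) (sym (at-+ₚ σ δ k)) (≤-trans (<countGE⇒<at aσ k i k<c) (m≤m+n _ _))))
      where
      row : ∀ k → i < at (σ +ₚ δ) k → i < at σ k
      row k i<σₖ+δₖ with at δ k in e
      ... | zero  = subst (i <_) (trans (at-+ₚ σ δ k) (trans (cong (at σ k +_) e) (+-identityʳ _))) i<σₖ+δₖ
      ... | suc _ = ≤-trans i<ℓ (σ-wide k (subst (0 <_) (sym e) (s≤s z≤n)))

    countGE-above-ℓ : ∀ s → countGE (suc (ℓ + s)) (oplus σ γ δ) ≡ countGE (suc (ℓ + s)) (σ +ₚ δ)
    countGE-above-ℓ s = begin
      countGE (suc (ℓ + s)) (oplus σ γ δ)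
        ≡⟨ countGE-oplus σ γ δ (ℓ + s) ⟩
      countGE (suc (ℓ + s)) (σ +ₚ δ) + countGE (suc (ℓ + s)) (conj γ)
        ≡⟨ cong (countGE (suc (ℓ + s)) (σ +ₚ δ) +_) (trans (countGE-conj aγ (ℓ + s)) (γ-short (ℓ + s) (m≤m+n ℓ s))) ⟩
      countGE (suc (ℓ + s)) (σ +ₚ δ) + 0
        ≡⟨ +-identityʳ _ ⟩
      countGE (suc (ℓ + s)) (σ +ₚ δ) ∎
      where open ≡-Reasoning

    ∸-absorbs-δ : ∀ t → (at σ t + at δ t) ∸ ℓ ≡ (at σ t ∸ ℓ) + at δ t
    ∸-absorbs-δ t with at δ t in e
    ... | zero  = trans (cong (_∸ ℓ) (+-identityʳ _)) (sym (+-identityʳ _))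
    ... | suc d = +-∸-comm (suc d) (σ-wide t (subst (0 <_) (sym e) (s≤s z≤n)))

  twSeq-oplus-< : ∀ {i} → i < ℓ → twSeq ℓ (oplus σ γ δ) i ≡ twSeq ℓ σ i + twPair ℓ γ δ i
  twSeq-oplus-< {i} i<ℓ = begin
    twSeq ℓ (oplus σ γ δ) i                             ≡⟨ twSeq-< ℓ (oplus σ γ δ) i<ℓ ⟩
    countGE (suc i) (oplus σ γ δ)                       ≡⟨ countGE-oplus σ γ δ i ⟩
    countGE (suc i) (σ +ₚ δ) + countGE (suc i) (conj γ) ≡⟨ cong₂ _+_ (countGE-σ+δ i<ℓ) (countGE-conj aγ i) ⟩
    countGE (suc i) σ + at γ i                          ≡⟨ cong₂ _+_ (sym (twSeq-< ℓ σ i<ℓ)) (sym (twPair-< ℓ γ δ i<ℓ)) ⟩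
    twSeq ℓ σ i + twPair ℓ γ δ i                        ∎
    where open ≡-Reasoning

  twSeq-oplus-≥ : ∀ {i} → ℓ ≤ i → twSeq ℓ (oplus σ γ δ) i ≡ twSeq ℓ σ i + twPair ℓ γ δ i
  twSeq-oplus-≥ {i} ℓ≤i = begin
    twSeq ℓ (oplus σ γ δ) i      ≡⟨ twSeq-≥ (oplus-antitone σ γ δ) ℓ ℓ≤i ⟩
    at (oplus σ γ δ) t ∸ ℓ       ≡⟨ ≡-by-countGE-above (oplus-antitone σ γ δ) (+ₚ-antitone aσ aδ) ℓ countGE-above-ℓ t ⟩
    at (σ +ₚ δ) t ∸ ℓ            ≡⟨ cong (_∸ ℓ) (at-+ₚ σ δ t) ⟩
    (at σ t + at δ t) ∸ ℓ        ≡⟨ ∸-absorbs-δ t ⟩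
    (at σ t ∸ ℓ) + at δ t        ≡⟨ cong₂ _+_ (sym (twSeq-≥ aσ ℓ ℓ≤i)) (sym (twPair-≥ ℓ γ δ ℓ≤i)) ⟩
    twSeq ℓ σ i + twPair ℓ γ δ i ∎
    where
    open ≡-Reasoning
    t = i ∸ ℓ

  twSeq-oplus : ∀ i → twSeq ℓ (oplus σ γ δ) i ≡ twSeq ℓ σ i + twPair ℓ γ δ i
  twSeq-oplus = split-at ℓ twSeq-oplus-< twSeq-oplus-≥

≤-descend : ∀ {x′ x h h′} → x′ + h ≤ x + h′ → h′ ≤ x′ → h ≤ x
≤-descend {x′} {x} {h} {h′} step h′≤x′ =
  +-cancelʳ-≤ h′ h x (≤-trans (+-monoʳ-≤ h h′≤x′) (≤-trans (≤-reflexive (+-comm h x′)) step))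

∸-descend : ∀ {x′ x h h′} → x′ + h ≤ x + h′ → h′ ≤ x′ → x′ ∸ h′ ≤ x ∸ h
∸-descend {x′} {x} {h} {h′} step h′≤x′ =
  m+n≤o⇒m≤o∸n (x′ ∸ h′) (+-cancelʳ-≤ h′ _ x (subst (_≤ x + h′) regroup step))
  where
  regroup : x′ + h ≡ x′ ∸ h′ + h + h′
  regroup = trans (cong (_+ h) (sym (m∸n+n≡m h′≤x′))) (+-right-comm (x′ ∸ h′) h′ h)

≤-downwards : ∀ (f g : ℕ → ℕ) n → g n ≤ f n → (∀ k → k < n → f (suc k) + g k ≤ f k + g (suc k))
            → ∀ k → k ≤ n → g k ≤ f k
≤-downwards f g n gₙ≤fₙ step k k≤n = go (n ∸ k) k (m+[n∸m]≡n k≤n)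
  where
  go : ∀ o k → k + o ≡ n → g k ≤ f k
  go zero    k k+0≡n = subst (λ j → g j ≤ f j) (trans (sym k+0≡n) (+-identityʳ k)) gₙ≤fₙ
  go (suc o) k k+1+o≡n = ≤-descend (step k (≤-trans (s≤s (m≤m+n k o)) (≤-reflexive (trans (sym (+-suc k o)) k+1+o≡n))))
                                    (go o (suc k) (trans (sym (+-suc k o)) k+1+o≡n))

psum-cong : ∀ {f g : ℕ → ℕ} n → (∀ {i} → i < n → f i ≡ g i) → psum f n ≡ psum g n
psum-cong zero    _   = refl
psum-cong (suc n) f≡g = cong₂ _+_ (psum-cong n (f≡g ∘ m<n⇒m<1+n)) (f≡g ≤-refl)

psum-+ : ∀ (f g : ℕ → ℕ) n → psum (λ i → f i + g i) n ≡ psum f n + psum g n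
psum-+ f g zero    = refl
psum-+ f g (suc n) = trans (cong (_+ (f n + g n)) (psum-+ f g n)) (+-interchange (psum f n) (psum g n) (f n) (g n))

psum-* : ∀ M (f : ℕ → ℕ) n → psum (λ i → M * f i) n ≡ M * psum f n
psum-* M f zero    = sym (*-zeroʳ M)
psum-* M f (suc n) = trans (cong (_+ M * f n) (psum-* M f n)) (sym (*-distribˡ-+ M (psum f n) (f n)))

psum-+* : ∀ {f g h : ℕ → ℕ} c → (∀ i → f i ≡ g i + c * h i) → ∀ n → psum f n ≡ psum g n + c * psum h n
psum-+* {f} {g} {h} c e n =
  trans (psum-cong n (λ {i} _ → e i)) (trans (psum-+ g (λ i → c * h i) n) (cong (psum g n +_) (psum-* c h n)))

psum-split : ∀ (f : ℕ → ℕ) ℓ n → psum f (ℓ + n) ≡ psum f ℓ + psum (λ t → f (ℓ + t)) n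
psum-split f ℓ zero    = trans (cong (psum f) (+-identityʳ ℓ)) (sym (+-identityʳ _))
psum-split f ℓ (suc n) =
  trans (cong (psum f) (+-suc ℓ n)) (trans (cong (_+ f (ℓ + n)) (psum-split f ℓ n)) (+-assoc (psum f ℓ) _ _))

psum-suc : ∀ (f : ℕ → ℕ) n → psum f (suc n) ≡ f 0 + psum (f ∘ suc) n
psum-suc f zero    = +-comm 0 (f 0)
psum-suc f (suc n) = trans (cong (_+ f (suc n)) (psum-suc f n)) (+-assoc (f 0) _ _)

psum-mono : ∀ (f : ℕ → ℕ) {n m} → n ≤ m → psum f n ≤ psum f m
psum-mono f {n} n≤m with m≤n⇒∃[o]m+o≡n n≤m
... | o , refl = go o
  where
  go : ∀ o → psum f n ≤ psum f (n + o)
  go zero    = ≤-reflexive (cong (psum f) (sym (+-identityʳ n)))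
  go (suc o) = ≤-trans (go o) (≤-trans (m≤m+n _ _) (≤-reflexive (cong (psum f) (sym (+-suc n o)))))

psum-stable : ∀ (f : ℕ → ℕ) n → (∀ {i} → n ≤ i → f i ≡ 0) → ∀ {m} → n ≤ m → psum f m ≡ psum f n
psum-stable f n f≡0 n≤m with m≤n⇒∃[o]m+o≡n n≤m
... | o , refl = go o
  where
  go : ∀ o → psum f (n + o) ≡ psum f n
  go zero    = cong (psum f) (+-identityʳ n)
  go (suc o) = trans (cong (psum f) (+-suc n o)) (trans (cong₂ _+_ (go o) (f≡0 (m≤m+n n o))) (+-identityʳ _))

psum-at-bound : ∀ (f : ℕ → ℕ) T n → (∀ m → psum f m ≤ T) → T ≤ psum f n → ∀ {i} → n ≤ i → f i ≡ 0
psum-at-bound f T n bounded reached {i} n≤i = n≤0⇒n≡0 (+-cancelˡ-≤ (psum f i) (f i) 0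
  (≤-trans (bounded (suc i)) (≤-trans reached (≤-trans (psum-mono f n≤i) (≤-reflexive (sym (+-identityʳ _)))))))

psum-indicator : ∀ x ℓ → psum (λ j → if suc j ≤ᵇ x then 1 else 0) ℓ ≡ ℓ ⊓ x
psum-indicator x zero    = refl
psum-indicator x (suc ℓ) with suc ℓ ≤ᵇ x in e
... | true  = let ℓ<x = ≤ᵇ≡true⇒≤ e in
  trans (cong (_+ 1) (trans (psum-indicator x ℓ) (m≤n⇒m⊓n≡m (<⇒≤ ℓ<x))))
        (trans (+-comm ℓ 1) (sym (m≤n⇒m⊓n≡m ℓ<x)))
... | false = let x≤ℓ = ≤-pred (≤ᵇ≡false⇒> e) in
  trans (+-identityʳ _) (trans (psum-indicator x ℓ)
        (trans (m≥n⇒m⊓n≡n x≤ℓ) (sym (m≥n⇒m⊓n≡n (m≤n⇒m≤1+n x≤ℓ)))))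

psum-countGE : ∀ xs ℓ → psum (λ j → countGE (suc j) xs) ℓ ≡ sum (map (ℓ ⊓_) xs)
psum-countGE []       ℓ = psum-zero ℓ
  where
  psum-zero : ∀ ℓ → psum (λ _ → 0) ℓ ≡ 0
  psum-zero zero    = refl
  psum-zero (suc ℓ) = trans (+-identityʳ _) (psum-zero ℓ)
psum-countGE (x ∷ xs) ℓ =
  trans (psum-+ (λ j → if suc j ≤ᵇ x then 1 else 0) (λ j → countGE (suc j) xs) ℓ)
        (cong₂ _+_ (psum-indicator x ℓ) (psum-countGE xs ℓ))

psum-at : ∀ (g : ℕ → ℕ) → g 0 ≡ 0 → ∀ xs n → length xs ≤ n → psum (g ∘ at xs) n ≡ sum (map g xs)
psum-at g g0≡0 []       n       _ = go n
  where
  go : ∀ n → psum (λ _ → g 0) n ≡ 0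
  go zero    = refl
  go (suc n) = cong₂ _+_ (go n) g0≡0
psum-at g g0≡0 (x ∷ xs) (suc n) (s≤s len≤n) =
  trans (psum-suc (g ∘ at (x ∷ xs)) n) (cong (g x +_) (psum-at g g0≡0 xs n len≤n))

sum≡psum-at : ∀ xs n → length xs ≤ n → sum xs ≡ psum (at xs) n
sum≡psum-at xs n len≤n = trans (cong sum (sym (List.map-id xs))) (sym (psum-at (λ x → x) refl xs n len≤n))

sum-⊓-∸ : ∀ xs ℓ → sum xs ≡ sum (map (ℓ ⊓_) xs) + sum (map (_∸ ℓ) xs)
sum-⊓-∸ []       ℓ = refl
sum-⊓-∸ (x ∷ xs) ℓ = begin
  x + sum xs                                                     ≡⟨ cong₂ _+_ (sym (m⊓n+n∸m≡n ℓ x)) (sum-⊓-∸ xs ℓ) ⟩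
  (ℓ ⊓ x + (x ∸ ℓ)) + (sum (map (ℓ ⊓_) xs) + sum (map (_∸ ℓ) xs)) ≡⟨ +-interchange (ℓ ⊓ x) (x ∸ ℓ) _ _ ⟩
  (ℓ ⊓ x + sum (map (ℓ ⊓_) xs)) + ((x ∸ ℓ) + sum (map (_∸ ℓ) xs)) ∎
  where open ≡-Reasoning

size≡psum-twSeq-+ : ∀ {σ} → Antitone σ → ∀ ℓ n → length σ ≤ n → size σ ≡ psum (twSeq ℓ σ) (ℓ + n)
size≡psum-twSeq-+ {σ} a ℓ n len≤n = sym (begin
  psum (twSeq ℓ σ) (ℓ + n)
    ≡⟨ psum-split (twSeq ℓ σ) ℓ n ⟩
  psum (twSeq ℓ σ) ℓ + psum (λ t → twSeq ℓ σ (ℓ + t)) n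
    ≡⟨ cong₂ _+_ (psum-cong ℓ (twSeq-< ℓ σ)) (psum-cong n (λ {t} _ → twSeq-+ a ℓ t)) ⟩
  psum (λ j → countGE (suc j) σ) ℓ + psum (λ t → at σ t ∸ ℓ) n
    ≡⟨ cong₂ _+_ (psum-countGE σ ℓ) (psum-at (_∸ ℓ) (0∸n≡0 ℓ) σ n len≤n) ⟩
  sum (map (ℓ ⊓_) σ) + sum (map (_∸ ℓ) σ)
    ≡⟨ sym (sum-⊓-∸ σ ℓ) ⟩
  size σ                                                   ∎)
  where open ≡-Reasoning

twSeq-beyond : ∀ {σ} → Antitone σ → ∀ ℓ {i} → ℓ + length σ ≤ i → twSeq ℓ σ i ≡ 0
twSeq-beyond {σ} a ℓ {i} ℓ+len≤i = begin
  twSeq ℓ σ i        ≡⟨ twSeq-≥ a ℓ (≤-trans (m≤m+n ℓ _) ℓ+len≤i) ⟩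
  at σ (i ∸ ℓ) ∸ ℓ   ≡⟨ cong (_∸ ℓ) (at-≥length σ len≤i-ℓ) ⟩
  0 ∸ ℓ              ≡⟨ 0∸n≡0 ℓ ⟩
  0                  ∎
  where
  open ≡-Reasoning
  len≤i-ℓ : length σ ≤ i ∸ ℓ
  len≤i-ℓ = subst (_≤ i ∸ ℓ) (m+n∸m≡n ℓ (length σ)) (∸-monoˡ-≤ ℓ ℓ+len≤i)

size≡psum-twSeq : ∀ {σ} → Antitone σ → ∀ ℓ {n} → ℓ + length σ ≤ n → size σ ≡ psum (twSeq ℓ σ) n
size≡psum-twSeq {σ} a ℓ ℓ+len≤n =
  trans (size≡psum-twSeq-+ a ℓ (length σ) ≤-refl) (sym (psum-stable (twSeq ℓ σ) (ℓ + length σ) (twSeq-beyond a ℓ) ℓ+len≤n))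

psum-twSeq-≤-size : ∀ {σ} → Antitone σ → ∀ ℓ n → psum (twSeq ℓ σ) n ≤ size σ
psum-twSeq-≤-size {σ} a ℓ n = ≤-trans (psum-mono (twSeq ℓ σ) (m≤m+n n (ℓ + length σ)))
                                      (≤-reflexive (sym (size≡psum-twSeq a ℓ (m≤n+m _ n))))

twSeq-injective : ∀ ℓ {σ τ} → IsPartition σ → IsPartition τ → (∀ i → twSeq ℓ σ i ≡ twSeq ℓ τ i) → σ ≡ τ
twSeq-injective ℓ {σ} {τ} pσ@(_ , σ>0) pτ@(_ , τ>0) e =
  at-injective σ>0 τ>0 (λ k → ≡-by-< (row-⊆ aσ aτ e k) (row-⊆ aτ aσ (sym ∘ e) k))
  where
  aσ = partition⇒antitone pσ
  aτ = partition⇒antitone pτ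
  row-⊆ : ∀ {σ τ} → Antitone σ → Antitone τ → (∀ i → twSeq ℓ σ i ≡ twSeq ℓ τ i)
        → ∀ k t → t < at σ k → t < at τ k
  row-⊆ {σ} {τ} aσ aτ e k t t<σₖ with t ℕ.<? ℓ
  ... | yes t<ℓ = <countGE⇒<at aτ k t
                    (subst (k <_) (trans (sym (twSeq-< ℓ σ t<ℓ)) (trans (e t) (twSeq-< ℓ τ t<ℓ))) (<at⇒<countGE aσ k t t<σₖ))
  ... | no  t≮ℓ = subst (_< at τ k) (m+[n∸m]≡n (≮⇒≥ t≮ℓ)) (<∸⇒+< ℓ
                    (subst (t ∸ ℓ <_) (trans (sym (twSeq-+ aσ ℓ k)) (trans (e (ℓ + k)) (twSeq-+ aτ ℓ k)))
                      (+<⇒<∸ ℓ (subst (_< at σ k) (sym (m+[n∸m]≡n (≮⇒≥ t≮ℓ))) t<σₖ))))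

-- If σ had fewer than ℓ columns in row k, its partial sums would reach |σ| = |B| at ℓ + k,
-- strictly before those of B.
≥ℓ-below : ∀ {σ B} ℓ → Antitone σ → Antitone B → TwLeq ℓ σ B → ∀ k → 0 < twSeq ℓ B (ℓ + k) → ℓ ≤ at σ k
≥ℓ-below {σ} {B} ℓ aσ aB (|σ|≡|B| , σ⊴B) k 0<B⁺ₖ with ℓ ℕ.≤? at σ k
... | yes ℓ≤σₖ = ℓ≤σₖ
... | no  ℓ≰σₖ = ⊥-elim (<-irrefl refl |B|<|B|)
  where
  σ-ends : ∀ {i} → ℓ + k ≤ i → twSeq ℓ σ i ≡ 0
  σ-ends {i} ℓ+k≤i = trans (twSeq-≥ aσ ℓ (≤-trans (m≤m+n ℓ k) ℓ+k≤i))
    (m≤n⇒m∸n≡0 (≤-trans (antitone-mono aσ k≤i-ℓ) (<⇒≤ (≰⇒> ℓ≰σₖ))))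
    where
    k≤i-ℓ : k ≤ i ∸ ℓ
    k≤i-ℓ = subst (_≤ i ∸ ℓ) (m+n∸m≡n ℓ k) (∸-monoˡ-≤ ℓ ℓ+k≤i)
  |σ|≡psum : size σ ≡ psum (twSeq ℓ σ) (ℓ + k)
  |σ|≡psum = trans (size≡psum-twSeq aσ ℓ (m≤n+m (ℓ + length σ) (ℓ + k)))
                   (psum-stable (twSeq ℓ σ) (ℓ + k) σ-ends (m≤m+n _ _))
  |B|<|B| : size B < size B
  |B|<|B| = begin-strict
    size B                                ≡⟨ sym |σ|≡|B| ⟩
    size σ                                ≡⟨ |σ|≡psum ⟩
    psum (twSeq ℓ σ) (ℓ + k)              ≤⟨ σ⊴B (ℓ + k) ⟩
    psum (twSeq ℓ B) (ℓ + k)              <⟨ m<m+n _ 0<B⁺ₖ ⟩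
    psum (twSeq ℓ B) (suc (ℓ + k))        ≤⟨ psum-twSeq-≤-size aB ℓ _ ⟩
    size B                                ∎
    where open ≤-Reasoning

-- Every twisted sequence comes from a partition: row k of the partition has
-- #{j < ℓ | k < d j} boxes from the minus part and d (ℓ + k) from the plus part.
module Realise (ℓ : ℕ) (d : ℕ → ℕ) (N : ℕ)
  (minus-antitone : ∀ j → suc j < ℓ → d (suc j) ≤ d j)
  (plus-antitone  : ∀ t → d (ℓ + suc t) ≤ d (ℓ + t))
  (junction       : 0 < ℓ → ∀ t → 0 < d (ℓ + t) → t < d (ℓ ∸ 1))
  (plus-finite    : ∀ t → N ≤ t → d (ℓ + t) ≡ 0) where

  private
    minus : List ℕ
    minus = map (λ j → d (j ∸ 1)) (oneTo ℓ)

    at-minus-< : ∀ {i} → i < ℓ → at minus i ≡ d i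
    at-minus-< = at-map-oneTo-< (λ j → d (j ∸ 1)) ℓ

    at-minus-≥ : ∀ {i} → ℓ ≤ i → at minus i ≡ 0
    at-minus-≥ = at-map-oneTo-≥ (λ j → d (j ∸ 1)) ℓ

    minus-anti : Antitone minus
    minus-anti = mkAntitone step
      where
      step : ∀ i → at minus (suc i) ≤ at minus i
      step i with suc i ℕ.<? ℓ
      ... | yes 1+i<ℓ = subst₂ _≤_ (sym (at-minus-< 1+i<ℓ)) (sym (at-minus-< (<⇒≤ 1+i<ℓ))) (minus-antitone i 1+i<ℓ)
      ... | no  1+i≮ℓ = ≤-trans (≤-reflexive (at-minus-≥ (≮⇒≥ 1+i≮ℓ))) z≤n

    length-minus : length minus ≡ ℓ
    length-minus = length-map-oneTo (λ j → d (j ∸ 1)) ℓ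

    minus-count : ℕ → ℕ
    minus-count k = countGE (suc k) minus

    minus-count-≤ : ∀ k → minus-count k ≤ ℓ
    minus-count-≤ k = subst (minus-count k ≤_) length-minus (countGE-≤-length (suc k) minus)

    minus-count-full : ∀ t → 0 < d (ℓ + t) → minus-count t ≡ ℓ
    minus-count-full t 0<dₜ with 0 ℕ.<? ℓ
    ... | no  0≮ℓ = ≤-antisym (minus-count-≤ t) (subst (_≤ minus-count t) (sym (n≤0⇒n≡0 (≮⇒≥ 0≮ℓ))) z≤n)
    ... | yes 0<ℓ = ≤-antisym (minus-count-≤ t) (subst (_≤ minus-count t) (suc[n∸1]≡n 0<ℓ)
                      (<at⇒<countGE minus-anti (ℓ ∸ 1) t (subst (t <_) (sym (at-minus-< (n∸1<n 0<ℓ))) (junction 0<ℓ t 0<dₜ))))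

    row : ℕ → ℕ
    row k = minus-count k + d (ℓ + k)

    rows : ℕ
    rows = N + d 0

    row-beyond : ∀ k → rows ≤ k → row k ≡ 0
    row-beyond k rows≤k = cong₂ _+_
      (countGE-all< k minus λ j →
        ≤-trans (antitone-mono minus-anti (z≤n {j})) (≤-trans minus₀≤d₀ (≤-trans (m≤n+m (d 0) N) rows≤k)))
      (plus-finite k (≤-trans (m≤m+n N (d 0)) rows≤k))
      where
      minus₀≤d₀ : at minus 0 ≤ d 0
      minus₀≤d₀ = split-at {λ i → at minus i ≤ d i} ℓ
        (≤-reflexive ∘ at-minus-<) (λ ℓ≤0 → ≤-trans (≤-reflexive (at-minus-≥ ℓ≤0)) z≤n) 0

    rowList : List ℕ
    rowList = map (λ k → row (k ∸ 1)) (oneTo rows)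

    at-rowList : ∀ k → at rowList k ≡ row k
    at-rowList = split-at rows (at-map-oneTo-< (λ k → row (k ∸ 1)) rows)
      (λ {k} rows≤k → trans (at-map-oneTo-≥ (λ k → row (k ∸ 1)) rows rows≤k) (sym (row-beyond k rows≤k)))

    rowList-anti : Antitone rowList
    rowList-anti = antitone-via row at-rowList λ k → +-mono-≤ (countGE-antitone minus (n≤1+n (suc k))) (plus-antitone k)

  σ : List ℕ
  σ = nonzero rowList

  private
    at-σ : ∀ k → at σ k ≡ row k
    at-σ k = trans (at-nonzero rowList-anti k) (at-rowList k)

  σ-antitone : Antitone σ
  σ-antitone = nonzero-antitone rowList-anti

  σ-isPartition : IsPartition σ
  σ-isPartition = antitone⇒linked σ-antitone , nonzero-positive rowList

  private
    columns-of-σ : ∀ {i} → i < ℓ → ∀ k → k < countGE (suc i) σ → k < d i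
    columns-of-σ {i} i<ℓ k k<c with d (ℓ + k) in e
    ... | zero  = subst (k <_) (at-minus-< i<ℓ) (<countGE⇒<at minus-anti i k
                    (subst (i <_) (trans (at-σ k) (trans (cong (minus-count k +_) e) (+-identityʳ _)))
                           (<countGE⇒<at σ-antitone k i k<c)))
    ... | suc _ = ≤-trans (junction (≤-<-trans z≤n i<ℓ) k (subst (0 <_) (sym e) (s≤s z≤n)))
                    (subst₂ _≤_ (at-minus-< (n∸1<n (≤-<-trans z≤n i<ℓ))) (at-minus-< i<ℓ)
                            (antitone-mono minus-anti (<⇒≤∸1 i<ℓ)))

    columns-to-σ : ∀ {i} → i < ℓ → ∀ k → k < d i → k < countGE (suc i) σ
    columns-to-σ {i} i<ℓ k k<dᵢ = <at⇒<countGE σ-antitone k i (subst (i <_) (sym (at-σ k))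
      (≤-trans (<at⇒<countGE minus-anti i k (subst (k <_) (sym (at-minus-< i<ℓ)) k<dᵢ)) (m≤m+n _ _)))

    plus-of-σ : ∀ t → row t ∸ ℓ ≡ d (ℓ + t)
    plus-of-σ t with d (ℓ + t) in e
    ... | zero  = trans (cong (_∸ ℓ) (+-identityʳ _)) (m≤n⇒m∸n≡0 (minus-count-≤ t))
    ... | suc x = trans (cong (λ c → (c + suc x) ∸ ℓ) (minus-count-full t (subst (0 <_) (sym e) (s≤s z≤n))))
                        (m+n∸m≡n ℓ (suc x))

  twSeq-σ : ∀ i → twSeq ℓ σ i ≡ d i
  twSeq-σ = split-at ℓ
    (λ i<ℓ → trans (twSeq-< ℓ σ i<ℓ) (≡-by-< (columns-of-σ i<ℓ) (columns-to-σ i<ℓ)))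
    (λ {i} ℓ≤i → begin
      twSeq ℓ σ i              ≡⟨ twSeq-≥ σ-antitone ℓ ℓ≤i ⟩
      at σ (i ∸ ℓ) ∸ ℓ         ≡⟨ cong (_∸ ℓ) (at-σ (i ∸ ℓ)) ⟩
      row (i ∸ ℓ) ∸ ℓ          ≡⟨ plus-of-σ (i ∸ ℓ) ⟩
      d (ℓ + (i ∸ ℓ))          ≡⟨ cong d (m+[n∸m]≡n ℓ≤i) ⟩
      d i                      ∎)
    where open ≡-Reasoning

-- Reading off the bound L

open import Data.Integer using (+_; +≤+)

maxList≤⇒all≤ : ∀ xs {z} → maxList xs ℚ.≤ z → All (ℚ._≤ z) xs
maxList≤⇒all≤ []       _ = []
maxList≤⇒all≤ (x ∷ xs) h = go x xs h
  where
  go : ∀ x xs {z} → foldr ℚ._⊔_ x xs ℚ.≤ z → All (ℚ._≤ z) (x ∷ xs)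
  go x []       h = h ∷ []
  go x (y ∷ ys) h with go x ys (ℚP.p⊔q≤r⇒q≤r y _ h)
  ... | hx ∷ hs = hx ∷ ℚP.p⊔q≤r⇒p≤r y _ h ∷ hs

∈⇒≤maxList : ∀ {x} xs → x ∈ xs → x ℚ.≤ maxList xs
∈⇒≤maxList (y ∷ ys) = go y ys
  where
  go : ∀ {x} y ys → x ∈ (y ∷ ys) → x ℚ.≤ foldr ℚ._⊔_ y ys
  go y []       (here refl)         = ℚP.≤-refl
  go y (z ∷ zs) (here refl)         = ℚP.p≤q⇒p≤r⊔q z (go y zs (here refl))
  go y (z ∷ zs) (there (here refl)) = ℚP.p≤p⊔q z _
  go y (z ∷ zs) (there (there x∈)) = ℚP.p≤q⇒p≤r⊔q z (go y zs (there x∈))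

∈-oneTo : ∀ {k} m → 0 < k → k ≤ m → k ∈ oneTo m
∈-oneTo {suc k} zero    _ ()
∈-oneTo {k}     (suc m) 0<k k≤1+m with k ℕ.≟ suc m
... | yes refl = ∈-++⁺ʳ (oneTo m) (here refl)
... | no  k≢   = ∈-++⁺ˡ (∈-oneTo m 0<k (≤-pred (≤∧≢⇒< k≤1+m k≢)))

frac≤⇒≤* : ∀ a n M → 0 < n → frac a n ℚ.≤ (+ M) ℚ./ 1 → a ℤ.≤ + M ℤ.* + n
frac≤⇒≤* a (suc d) M _ a/n≤M = subst₂ ℤ._≤_ lhs≡a rhs≡Mn scaled
  where
  x = ↥ (a ℚ./ suc d)
  y = ↧ (a ℚ./ suc d)
  u = ↥ ((+ M) ℚ./ 1)
  v = ↧ ((+ M) ℚ./ 1)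
  g = gcd a (+ suc d)
  h = gcd (+ M) (+ 1)
  -- cross-multiply the reduced fractions, then undo both reductions by multiplying with the gcds
  scaled : x ℤ.* v ℤ.* g ℤ.* h ℤ.≤ u ℤ.* y ℤ.* g ℤ.* h
  scaled = ℤP.*-monoʳ-≤-nonNeg h (ℤP.*-monoʳ-≤-nonNeg g (ℚP.drop-*≤* a/n≤M))
  lhs≡a : x ℤ.* v ℤ.* g ℤ.* h ≡ a
  lhs≡a = trans (regroup x v g h) (trans (cong₂ ℤ._*_ (ℚP.↥-/ a (suc d)) (ℚP.↧-/ (+ M) 1)) (ℤP.*-identityʳ a))
    where
    regroup : ∀ (x v g h : ℤ) → x ℤ.* v ℤ.* g ℤ.* h ≡ (x ℤ.* g) ℤ.* (v ℤ.* h)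
    regroup = ZSolver.solve-∀
  rhs≡Mn : u ℤ.* y ℤ.* g ℤ.* h ≡ + M ℤ.* + suc d
  rhs≡Mn = trans (regroup u y g h) (cong₂ ℤ._*_ (ℚP.↥-/ (+ M) 1) (ℚP.↧-/ a (suc d)))
    where
    regroup : ∀ (u y g h : ℤ) → u ℤ.* y ℤ.* g ℤ.* h ≡ (u ℤ.* h) ℤ.* (y ℤ.* g)
    regroup = ZSolver.solve-∀

Lk≤LBox : ∀ lam ω κ j → suc j < len κ → Lk (toZ ω) (toZ lam) κ (suc j) ℚ.≤ LBox (len κ) lam ω κ
Lk≤LBox lam ω κ j 1+j<ℓ with len κ
... | suc m with suc m ℕ.<? suc m
...   | yes m<m = ⊥-elim (n≮n _ m<m)
...   | no  _   = ∈⇒≤maxList (map (Lk (toZ ω) (toZ lam) κ) (oneTo m) ++ _ ∷ [])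
                    (∈-++⁺ˡ (∈-map⁺ (Lk (toZ ω) (toZ lam) κ) (∈-oneTo m (s≤s z≤n) (≤-pred 1+j<ℓ))))

Lk≤LDom : ∀ lam f κ k → 0 < k → k ≤ len κ → Lk f lam κ k ℚ.≤ LDom lam f κ
Lk≤LDom lam f κ k 0<k k≤ℓ =
  ∈⇒≤maxList (map (Lk f lam κ) (oneTo (len κ))) (∈-map⁺ (Lk f lam κ) (∈-oneTo (len κ) 0<k k≤ℓ))

-- LBound defines ω⁺ +(c) in term (2) by a local case split; it is exposed here through
-- any sequence agreeing with it.
module _ (κm κp lam ω : List ℕ) where
  private
    ℓ = len κm
    λ⁻ = decMinus ℓ lam
    λ⁺ = decPlus ℓ lam
    ω⁻ = decMinus ℓ ω
    ω⁺ = decPlus ℓ ω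
    c : ℤ
    c = + size λ⁺ ℤ.- + size ω⁺

  record BoundedBy (z : ℚ) : Set where
    constructor bounded
    field
      minus-bound     : LBox ℓ λ⁻ ω⁻ κm ℚ.≤ z
      shifted         : ℕ → ℤ
      shifted-1       : shifted 1 ≡ toZ ω⁺ 1 ℤ.+ c
      shifted-2+      : ∀ k → shifted (suc (suc k)) ≡ toZ ω⁺ (suc (suc k))
      plus-bound      : LDom (toZ λ⁺) shifted κp ℚ.≤ z
      first-row-bound : ¬ (part κp 1 ≡ part κp 2) →
        frac (toZ ω⁺ 1 ℤ.+ toZ ω⁺ 2 ℤ.- (+ 2) ℤ.* toZ λ⁺ 1 ℤ.+ (+ 2) ℤ.* (+ size λ⁺) ℤ.- (+ 2) ℤ.* (+ size ω⁺))
             (part κp 1 ∸ part κp 2) ℚ.≤ z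
      junction-bound  : ¬ (ℓ ≡ 0) →
        frac (+ (len λ⁺ ⊔ len κp) ℤ.+ + size ω⁻ ℤ.- + size λ⁻ ℤ.- + part ω⁻ ℓ) (part κm ℓ) ℚ.≤ z

  LBound≤⇒BoundedBy : ∀ z → LBound κm κp lam ω ℚ.≤ z → BoundedBy z
  LBound≤⇒BoundedBy z L≤z with part κp 1 ℕ.≟ part κp 2 | ℓ ℕ.≟ 0
  ... | yes κ₁≡κ₂ | yes ℓ≡0 with maxList≤⇒all≤ (_ ∷ _ ∷ []) L≤z
  ...   | b₁ ∷ b₂ ∷ [] =
    bounded b₁ _ refl (λ _ → refl) b₂ (λ κ₁≢κ₂ → ⊥-elim (κ₁≢κ₂ κ₁≡κ₂)) (λ ℓ≢0 → ⊥-elim (ℓ≢0 ℓ≡0))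
  LBound≤⇒BoundedBy z L≤z | yes κ₁≡κ₂ | no _ with maxList≤⇒all≤ (_ ∷ _ ∷ _ ∷ []) L≤z
  ...   | b₁ ∷ b₂ ∷ b₄ ∷ [] =
    bounded b₁ _ refl (λ _ → refl) b₂ (λ κ₁≢κ₂ → ⊥-elim (κ₁≢κ₂ κ₁≡κ₂)) (λ _ → b₄)
  LBound≤⇒BoundedBy z L≤z | no _ | yes ℓ≡0 with maxList≤⇒all≤ (_ ∷ _ ∷ _ ∷ []) L≤z
  ...   | b₁ ∷ b₂ ∷ b₃ ∷ [] =
    bounded b₁ _ refl (λ _ → refl) b₂ (λ _ → b₃) (λ ℓ≢0 → ⊥-elim (ℓ≢0 ℓ≡0))
  LBound≤⇒BoundedBy z L≤z | no _ | no _ with maxList≤⇒all≤ (_ ∷ _ ∷ _ ∷ _ ∷ []) L≤z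
  ...   | b₁ ∷ b₂ ∷ b₃ ∷ b₄ ∷ [] =
    bounded b₁ _ refl (λ _ → refl) b₂ (λ _ → b₃) (λ _ → b₄)

S-toZ : ∀ xs n → S (toZ xs) n ≡ + psum (at xs) n
S-toZ xs zero    = refl
S-toZ xs (suc n) = cong (ℤ._+ + at xs n) (S-toZ xs n)

S-decMinus : ∀ ℓ σ {n} → n ≤ ℓ → S (toZ (decMinus ℓ σ)) n ≡ + psum (twSeq ℓ σ) n
S-decMinus ℓ σ {n} n≤ℓ = trans (S-toZ _ n) (cong +_ (psum-cong n (λ i<n → at-decMinus ℓ σ (≤-trans i<n n≤ℓ))))

S-decPlus : ∀ {σ} → Antitone σ → ∀ ℓ n → S (toZ (decPlus ℓ σ)) n ≡ + psum (λ t → twSeq ℓ σ (ℓ + t)) n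
S-decPlus a ℓ n = trans (S-toZ _ n) (cong +_ (psum-cong n (λ {t} _ → at-decPlus≡twSeq a ℓ t)))

size-decMinus : ∀ ℓ σ → size (decMinus ℓ σ) ≡ psum (twSeq ℓ σ) ℓ
size-decMinus ℓ σ = trans (sum≡psum-at (decMinus ℓ σ) ℓ (≤-reflexive (length-map-oneTo (part (conj σ)) ℓ)))
                          (psum-cong ℓ (at-decMinus ℓ σ))

length-decPlus : ∀ ℓ σ → length (decPlus ℓ σ) ≤ length σ
length-decPlus ℓ σ = ≤-trans (length-nonzero (σ -ₚ conj (decMinus ℓ σ))) (length-minusₚ σ (conj (decMinus ℓ σ)))
  where
  length-minusₚ : ∀ xs ys → length (xs -ₚ ys) ≤ length xs
  length-minusₚ []       ys       = z≤n
  length-minusₚ (x ∷ xs) []       = ≤-refl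
  length-minusₚ (x ∷ xs) (y ∷ ys) = s≤s (length-minusₚ xs ys)

size-decPlus : ∀ {σ} → Antitone σ → ∀ ℓ → size (decPlus ℓ σ) ≡ psum (λ t → twSeq ℓ σ (ℓ + t)) (length σ)
size-decPlus {σ} a ℓ = trans (sum≡psum-at (decPlus ℓ σ) (length σ) (length-decPlus ℓ σ))
                             (psum-cong (length σ) (λ {t} _ → at-decPlus≡twSeq a ℓ t))

size-decompose : ∀ {σ} → Antitone σ → ∀ ℓ → size σ ≡ size (decMinus ℓ σ) + size (decPlus ℓ σ)
size-decompose {σ} a ℓ = begin
  size σ
    ≡⟨ size≡psum-twSeq-+ a ℓ (length σ) ≤-refl ⟩
  psum (twSeq ℓ σ) (ℓ + length σ)
    ≡⟨ psum-split (twSeq ℓ σ) ℓ (length σ) ⟩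
  psum (twSeq ℓ σ) ℓ + psum (λ t → twSeq ℓ σ (ℓ + t)) (length σ)
    ≡⟨ cong₂ _+_ (sym (size-decMinus ℓ σ)) (sym (size-decPlus a ℓ)) ⟩
  size (decMinus ℓ σ) + size (decPlus ℓ σ) ∎
  where open ≡-Reasoning

len-decPlus : ∀ ℓ σ → len (decPlus ℓ σ) ≡ length (decPlus ℓ σ)
len-decPlus ℓ σ = len≡length (nonzero-positive (σ -ₚ conj (decMinus ℓ σ)))

S-shift-first : ∀ (f g : ℕ → ℤ) c → f 1 ≡ g 1 ℤ.+ c → (∀ k → f (suc (suc k)) ≡ g (suc (suc k)))
              → ∀ n → S f (suc n) ≡ S g (suc n) ℤ.+ c
S-shift-first f g c f₁ f₂₊ zero    = trans (ℤP.+-identityˡ (f 1)) (trans f₁ (cong (ℤ._+ c) (sym (ℤP.+-identityˡ (g 1)))))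
S-shift-first f g c f₁ f₂₊ (suc n) =
  trans (cong₂ ℤ._+_ (S-shift-first f g c f₁ f₂₊ n) (f₂₊ n)) (swap (S g (suc n)) c (g (suc (suc n))))
  where
  swap : ∀ (a c b : ℤ) → a ℤ.+ c ℤ.+ b ≡ a ℤ.+ b ℤ.+ c
  swap = ZSolver.solve-∀

private
  0≤-diff : ∀ {a b} → a ℤ.≤ b → + 0 ℤ.≤ b ℤ.- a
  0≤-diff = ℤP.i≤j⇒0≤j-i

  0≤-+ : ∀ {a b} → + 0 ℤ.≤ a → + 0 ℤ.≤ b → + 0 ℤ.≤ a ℤ.+ b
  0≤-+ = ℤP.+-mono-≤

frac-diff≤⇒≤* : ∀ M {a hi lo} → lo < hi → frac a (hi ∸ lo) ℚ.≤ (+ M) ℚ./ 1 → a ℤ.≤ + M ℤ.* (+ hi ℤ.- + lo)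
frac-diff≤⇒≤* M {a} {hi} {lo} lo<hi a/[hi-lo]≤M =
  subst (λ x → a ℤ.≤ + M ℤ.* x) (sym (trans (ℤP.m-n≡m⊖n hi lo) (ℤP.⊖-≥ (<⇒≤ lo<hi))))
    (frac≤⇒≤* a (hi ∸ lo) M (m<n⇒0<n∸m lo<hi) a/[hi-lo]≤M)

-- the numerator 2 S ω (k - 1) + ω k + ω (k + 1) - 2 S λ k of L_k
Lnum : ℤ → ℤ → ℤ → ℤ → ℤ
Lnum s a b t = (+ 2) ℤ.* s ℤ.+ a ℤ.+ b ℤ.- (+ 2) ℤ.* t

Lnum-cong : ∀ {s s' a a' b b' t t'} → s ≡ s' → a ≡ a' → b ≡ b' → t ≡ t' → Lnum s a b t ≡ Lnum s' a' b' t'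
Lnum-cong refl refl refl refl = refl

+≡+⇒-≡- : ∀ (a b c d : ℤ) → a ℤ.+ b ≡ c ℤ.+ d → b ℤ.- d ≡ c ℤ.- a
+≡+⇒-≡- a b c d a+b≡c+d = begin
  b ℤ.- d                 ≡⟨ add-sub a b d ⟩
  a ℤ.+ b ℤ.- a ℤ.- d     ≡⟨ cong (λ x → x ℤ.- a ℤ.- d) a+b≡c+d ⟩
  c ℤ.+ d ℤ.- a ℤ.- d     ≡⟨ add-sub-sub c d a ⟩
  c ℤ.- a                 ∎
  where
  open ≡-Reasoning
  add-sub : ∀ (a b d : ℤ) → b ℤ.- d ≡ a ℤ.+ b ℤ.- a ℤ.- d
  add-sub = ZSolver.solve-∀
  add-sub-sub : ∀ (c d a : ℤ) → c ℤ.+ d ℤ.- a ℤ.- d ≡ c ℤ.- a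
  add-sub-sub = ZSolver.solve-∀

-- The interval bounds at n, n + 1, n + 2 and L_k ≤ M make the twisted sequence drop from n
-- to n + 1 by at least as much as κ̂ does.
step-from-bounds : ∀ (p x y l w w₁ w₂ k κ₁ κ₂ M : ℤ)
  → p ℤ.+ x ℤ.+ y ℤ.≤ w ℤ.+ w₁ ℤ.+ w₂ ℤ.+ (+ 1 ℤ.+ M) ℤ.* (k ℤ.+ κ₁ ℤ.+ κ₂)
  → p ℤ.≤ w ℤ.+ (+ 1 ℤ.+ M) ℤ.* k
  → l ℤ.+ (+ 1 ℤ.+ M) ℤ.* (k ℤ.+ κ₁) ℤ.≤ p ℤ.+ x
  → Lnum w w₁ w₂ l ℤ.≤ M ℤ.* (κ₁ ℤ.- κ₂)
  → y ℤ.+ κ₁ ℤ.≤ x ℤ.+ κ₂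
step-from-bounds p x y l w w₁ w₂ k κ₁ κ₂ M up₂ up₀ low₁ bound =
  ℤP.0≤i-j⇒j≤i (subst (+ 0 ℤ.≤_) (combination p x y l w w₁ w₂ k κ₁ κ₂ M)
    (0≤-+ (0≤-+ (0≤-+ (0≤-+ (0≤-diff up₂) (0≤-diff up₀)) (0≤-diff low₁)) (0≤-diff low₁)) (0≤-diff bound)))
  where
  combination : ∀ (p x y l w w₁ w₂ k κ₁ κ₂ M : ℤ) →
    (w ℤ.+ w₁ ℤ.+ w₂ ℤ.+ (+ 1 ℤ.+ M) ℤ.* (k ℤ.+ κ₁ ℤ.+ κ₂) ℤ.- (p ℤ.+ x ℤ.+ y))
    ℤ.+ (w ℤ.+ (+ 1 ℤ.+ M) ℤ.* k ℤ.- p)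
    ℤ.+ (p ℤ.+ x ℤ.- (l ℤ.+ (+ 1 ℤ.+ M) ℤ.* (k ℤ.+ κ₁)))
    ℤ.+ (p ℤ.+ x ℤ.- (l ℤ.+ (+ 1 ℤ.+ M) ℤ.* (k ℤ.+ κ₁)))
    ℤ.+ (M ℤ.* (κ₁ ℤ.- κ₂) ℤ.- ((+ 2) ℤ.* w ℤ.+ w₁ ℤ.+ w₂ ℤ.- (+ 2) ℤ.* l))
    ≡ x ℤ.+ κ₂ ℤ.- (y ℤ.+ κ₁)
  combination = ZSolver.solve-∀

-- The interval bounds at n and n + 1 and term (4) of L ≤ M leave room m above κ̂ at n.
junction-from-bounds : ∀ (p x l w k κ m M : ℤ)
  → l ℤ.+ (+ 1 ℤ.+ M) ℤ.* (k ℤ.+ κ) ℤ.≤ p ℤ.+ x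
  → p ℤ.≤ w ℤ.+ (+ 1 ℤ.+ M) ℤ.* k
  → m ℤ.+ w ℤ.- l ℤ.≤ M ℤ.* κ
  → m ℤ.+ κ ℤ.≤ x
junction-from-bounds p x l w k κ m M low₁ up₀ bound =
  ℤP.0≤i-j⇒j≤i (subst (+ 0 ℤ.≤_) (combination p x l w k κ m M)
    (0≤-+ (0≤-+ (0≤-diff low₁) (0≤-diff up₀)) (0≤-diff bound)))
  where
  combination : ∀ (p x l w k κ m M : ℤ) →
    (p ℤ.+ x ℤ.- (l ℤ.+ (+ 1 ℤ.+ M) ℤ.* (k ℤ.+ κ)))
    ℤ.+ (w ℤ.+ (+ 1 ℤ.+ M) ℤ.* k ℤ.- p)
    ℤ.+ (M ℤ.* κ ℤ.- (m ℤ.+ w ℤ.- l))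
    ≡ x ℤ.- (m ℤ.+ κ)
  combination = ZSolver.solve-∀

-- Shifting by multiples of (κ⁻ , κ⁺)

+-*-suc : ∀ a M k → a + M * k + k ≡ a + suc M * k
+-*-suc a M k = trans (+-assoc a (M * k) k) (cong (_+_ a) (+-comm (M * k) k))

module Shift (κm κp : List ℕ) (pκm : IsPartition κm) (pκp : IsPartition κp) where

  ℓ b : ℕ
  ℓ = len κm
  b = len κp

  κ̂ : ℕ → ℕ
  κ̂ = twPair ℓ κm κp

  |κ̂| : ℕ
  |κ̂| = psum κ̂ (ℓ + b)

  aκm : Antitone κm
  aκm = partition⇒antitone pκm

  aκp : Antitone κp
  aκp = partition⇒antitone pκp

  κm-short : ∀ k → ℓ ≤ k → at κm k ≡ 0
  κm-short k ℓ≤k = at-≥length κm (subst (_≤ k) (len≡length (proj₂ pκm)) ℓ≤k)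

  κp-short : ∀ k → b ≤ k → at κp k ≡ 0
  κp-short k b≤k = at-≥length κp (subst (_≤ k) (len≡length (proj₂ pκp)) b≤k)

  κp-support : ∀ k → 0 < at κp k → k < b
  κp-support k 0<κₖ = subst (k <_) (sym (len≡length (proj₂ pκp))) (0<at⇒<length κp 0<κₖ)

  κ̂-+ : ∀ t → κ̂ (ℓ + t) ≡ at κp t
  κ̂-+ = twPair-+ ℓ κm κp

  κ̂-beyond : ∀ {i} → ℓ + b ≤ i → κ̂ i ≡ 0
  κ̂-beyond {i} ℓ+b≤i = trans (twPair-≥ ℓ κm κp (≤-trans (m≤m+n ℓ b) ℓ+b≤i))
    (κp-short (i ∸ ℓ) (subst (_≤ i ∸ ℓ) (m+n∸m≡n ℓ b) (∸-monoˡ-≤ ℓ ℓ+b≤i)))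

  Wide : List ℕ → Set
  Wide σ = ∀ k → k < b → ℓ ≤ at σ k

  Full : List ℕ → Set
  Full σ = ∀ k → k < b → 0 < twSeq ℓ σ (ℓ + k)

  twSeq-oplus-κ : ∀ {σ} → Antitone σ → Wide σ → ∀ i → twSeq ℓ (oplus σ κm κp) i ≡ twSeq ℓ σ i + κ̂ i
  twSeq-oplus-κ aσ wide = twSeq-oplus ℓ aσ aκm aκp κm-short (λ k 0<κₖ → wide k (κp-support k 0<κₖ))

  twSeq-oplusM : ∀ {σ} → Antitone σ → Wide σ → ∀ M i → twSeq ℓ (oplusM σ M κm κp) i ≡ twSeq ℓ σ i + M * κ̂ i
  twSeq-oplusM {σ} aσ wide M i = trans
    (twSeq-oplus ℓ aσ (scale-antitone M aκm) (scale-antitone M aκp)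
      (λ k ℓ≤k → trans (at-scale M κm k) (trans (cong (M *_) (κm-short k ℓ≤k)) (*-zeroʳ M)))
      (λ k 0<Mκₖ → wide k (κp-support k (κp-nonzero k 0<Mκₖ))) i)
    (cong (_+_ (twSeq ℓ σ i)) (twPair-scale ℓ M κm κp i))
    where
    κp-nonzero : ∀ k → 0 < at (scale M κp) k → 0 < at κp k
    κp-nonzero k 0<Mκₖ with at κp k in e
    ... | zero  = ⊥-elim (<⇒≢ 0<Mκₖ (sym (trans (at-scale M κp k) (trans (cong (M *_) e) (*-zeroʳ M)))))
    ... | suc _ = s≤s z≤n

  size-via-twSeq : ∀ {σ τ} c → Antitone σ → Antitone τ → (∀ i → twSeq ℓ σ i ≡ twSeq ℓ τ i + c * κ̂ i)
                 → size σ ≡ size τ + c * |κ̂|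
  size-via-twSeq {σ} {τ} c aσ aτ e = begin
    size σ                            ≡⟨ size≡psum-twSeq aσ ℓ (ℓ+-≤ (m≤m+n (length σ) _)) ⟩
    psum (twSeq ℓ σ) n                ≡⟨ psum-+* c e n ⟩
    psum (twSeq ℓ τ) n + c * psum κ̂ n ≡⟨ cong₂ _+_ (sym (size≡psum-twSeq aτ ℓ (ℓ+-≤ τ≤N)))
                                                   (cong (c *_) (psum-stable κ̂ (ℓ + b) κ̂-beyond (ℓ+-≤ b≤N))) ⟩
    size τ + c * |κ̂|                  ∎
    where
    open ≡-Reasoning
    N = length σ + (length τ + b)
    n = ℓ + N
    ℓ+-≤ : ∀ {x} → x ≤ N → ℓ + x ≤ n
    ℓ+-≤ = +-monoʳ-≤ ℓ
    τ≤N : length τ ≤ N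
    τ≤N = ≤-trans (m≤m+n (length τ) b) (m≤n+m _ (length σ))
    b≤N : b ≤ N
    b≤N = ≤-trans (m≤n+m b (length τ)) (m≤n+m _ (length σ))

  wide-below : ∀ {σ B} → Antitone σ → Antitone B → TwLeq ℓ σ B → Full B → Wide σ
  wide-below aσ aB σ⊴B full k k<b = ≥ℓ-below ℓ aσ aB σ⊴B k (full k k<b)

  full-oplusM : ∀ {σ} → Antitone σ → Wide σ → Full σ → ∀ M → Full (oplusM σ M κm κp)
  full-oplusM aσ wide full M k k<b =
    ≤-trans (full k k<b) (≤-trans (m≤m+n _ _) (≤-reflexive (sym (twSeq-oplusM aσ wide M (ℓ + k)))))

  private
    large⇒ℓ< : ∀ {ω} → Antitone ω → Large (suc ℓ) b ω → ∀ k → k < b → ℓ < at ω k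
    large⇒ℓ< aω (inj₁ ())
    large⇒ℓ< aω (inj₂ (inj₁ b≡0)) k k<b = ⊥-elim (<⇒≢ (≤-<-trans z≤n k<b) (sym b≡0))
    large⇒ℓ< {ω} aω (inj₂ (inj₂ ℓ<ω_b)) k k<b =
      ≤-trans (subst (suc ℓ ≤_) (cong (part ω) (sym (suc[n∸1]≡n (≤-<-trans z≤n k<b)))) ℓ<ω_b)
              (antitone-mono aω (<⇒≤∸1 k<b))

  large⇒wide : ∀ {ω} → Antitone ω → Large (suc ℓ) b ω → Wide ω
  large⇒wide aω large k k<b = <⇒≤ (large⇒ℓ< aω large k k<b)

  large⇒full : ∀ {ω} → Antitone ω → Large (suc ℓ) b ω → Full ω
  large⇒full aω large k k<b = subst (0 <_) (sym (twSeq-+ aω ℓ k)) (m<n⇒0<n∸m (large⇒ℓ< aω large k k<b))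

  module Interval (lam ω : List ℕ) (plam : IsPartition lam) (pω : IsPartition ω)
                  (wideω : Wide ω) (fullω : Full ω) (lam⊴ω : TwLeq ℓ lam ω) where

    aλ : Antitone lam
    aλ = partition⇒antitone plam

    aω : Antitone ω
    aω = partition⇒antitone pω

    wideλ : Wide lam
    wideλ = wide-below aλ aω lam⊴ω fullω

    A B : ℕ → List ℕ
    A M = oplusM lam M κm κp
    B M = oplusM ω M κm κp

    aA : ∀ M → Antitone (A M)
    aA M = oplus-antitone lam (scale M κm) (scale M κp)
    aB : ∀ M → Antitone (B M)
    aB M = oplus-antitone ω (scale M κm) (scale M κp)

    I : ℕ → List ℕ → Set
    I M = InTwInterval ℓ (A M) (B M)

    L W K : ℕ → ℕ
    L = psum (twSeq ℓ lam)
    W = psum (twSeq ℓ ω)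
    K = psum κ̂

    psum-A : ∀ M n → psum (twSeq ℓ (A M)) n ≡ L n + M * K n
    psum-A M = psum-+* M (twSeq-oplusM aλ wideλ M)

    psum-B : ∀ M n → psum (twSeq ℓ (B M)) n ≡ W n + M * K n
    psum-B M = psum-+* M (twSeq-oplusM aω wideω M)

    size-A : ∀ M → size (A M) ≡ size lam + M * |κ̂|
    size-A M = size-via-twSeq M (aA M) aλ (twSeq-oplusM aλ wideλ M)

    size-B : ∀ M → size (B M) ≡ size ω + M * |κ̂|
    size-B M = size-via-twSeq M (aB M) aω (twSeq-oplusM aω wideω M)

    wide-I : ∀ M {σ} → I M σ → Wide σ
    wide-I M (pσ , _ , _ , σ⊴B) =
      wide-below (partition⇒antitone pσ) (aB M) σ⊴B (full-oplusM aω wideω fullω M)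

    psum-oplus : ∀ {σ} → Antitone σ → Wide σ → ∀ n → psum (twSeq ℓ (oplus σ κm κp)) n ≡ psum (twSeq ℓ σ) n + K n
    psum-oplus {σ} aσ wide n = trans (psum-cong n (λ {i} _ → twSeq-oplus-κ aσ wide i)) (psum-+ (twSeq ℓ σ) κ̂ n)

    size-oplus : ∀ {σ} → Antitone σ → Wide σ → size (oplus σ κm κp) ≡ size σ + |κ̂|
    size-oplus {σ} aσ wide = trans
      (size-via-twSeq 1 (oplus-antitone σ κm κp) aσ λ i →
        trans (twSeq-oplus-κ aσ wide i) (cong (_+_ (twSeq ℓ σ i)) (sym (*-identityˡ (κ̂ i)))))
      (cong (_+_ (size σ)) (*-identityˡ |κ̂|))

    oplus-maps-I : ∀ M σ → I M σ → I (suc M) (oplus σ κm κp)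
    oplus-maps-I M σ Iσ@(pσ , |σ|≡|A| , (_ , A⊴σ) , (|σ|≡|B| , σ⊴B)) =
      oplus-isPartition σ κm κp , size-fσ≡A , (sym size-fσ≡A , A⊴fσ) , (size-fσ≡B , fσ⊴B)
      where
      aσ = partition⇒antitone pσ
      wide = wide-I M Iσ
      size-fσ≡A : size (oplus σ κm κp) ≡ size (A (suc M))
      size-fσ≡A = begin
        size (oplus σ κm κp)          ≡⟨ size-oplus aσ wide ⟩
        size σ + |κ̂|                  ≡⟨ cong (_+ |κ̂|) (trans |σ|≡|A| (size-A M)) ⟩
        size lam + M * |κ̂| + |κ̂|      ≡⟨ +-*-suc (size lam) M |κ̂| ⟩
        size lam + suc M * |κ̂|        ≡⟨ sym (size-A (suc M)) ⟩
        size (A (suc M))              ∎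
        where open ≡-Reasoning
      size-fσ≡B : size (oplus σ κm κp) ≡ size (B (suc M))
      size-fσ≡B = begin
        size (oplus σ κm κp)          ≡⟨ size-oplus aσ wide ⟩
        size σ + |κ̂|                  ≡⟨ cong (_+ |κ̂|) (trans |σ|≡|B| (size-B M)) ⟩
        size ω + M * |κ̂| + |κ̂|        ≡⟨ +-*-suc (size ω) M |κ̂| ⟩
        size ω + suc M * |κ̂|          ≡⟨ sym (size-B (suc M)) ⟩
        size (B (suc M))              ∎
        where open ≡-Reasoning
      A⊴fσ : ∀ n → psum (twSeq ℓ (A (suc M))) n ≤ psum (twSeq ℓ (oplus σ κm κp)) n
      A⊴fσ n = begin
        psum (twSeq ℓ (A (suc M))) n  ≡⟨ psum-A (suc M) n ⟩
        L n + suc M * K n             ≡⟨ sym (+-*-suc (L n) M (K n)) ⟩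
        L n + M * K n + K n           ≡⟨ cong (_+ K n) (sym (psum-A M n)) ⟩
        psum (twSeq ℓ (A M)) n + K n  ≤⟨ +-monoˡ-≤ (K n) (A⊴σ n) ⟩
        psum (twSeq ℓ σ) n + K n      ≡⟨ sym (psum-oplus aσ wide n) ⟩
        psum (twSeq ℓ (oplus σ κm κp)) n ∎
        where open ≤-Reasoning
      fσ⊴B : ∀ n → psum (twSeq ℓ (oplus σ κm κp)) n ≤ psum (twSeq ℓ (B (suc M))) n
      fσ⊴B n = begin
        psum (twSeq ℓ (oplus σ κm κp)) n ≡⟨ psum-oplus aσ wide n ⟩
        psum (twSeq ℓ σ) n + K n      ≤⟨ +-monoˡ-≤ (K n) (σ⊴B n) ⟩
        psum (twSeq ℓ (B M)) n + K n  ≡⟨ cong (_+ K n) (psum-B M n) ⟩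
        W n + M * K n + K n           ≡⟨ +-*-suc (W n) M (K n) ⟩
        W n + suc M * K n             ≡⟨ sym (psum-B (suc M) n) ⟩
        psum (twSeq ℓ (B (suc M))) n  ∎
        where open ≤-Reasoning

    oplus-injective-I : ∀ M σ τ → I M σ → I M τ → oplus σ κm κp ≡ oplus τ κm κp → σ ≡ τ
    oplus-injective-I M σ τ Iσ@(pσ , _) Iτ@(pτ , _) fσ≡fτ = twSeq-injective ℓ pσ pτ λ i → +-cancelʳ-≡ _ _ _ (begin
      twSeq ℓ σ i + κ̂ i            ≡⟨ sym (twSeq-oplus-κ (partition⇒antitone pσ) (wide-I M Iσ) i) ⟩
      twSeq ℓ (oplus σ κm κp) i    ≡⟨ cong (λ ρ → twSeq ℓ ρ i) fσ≡fτ ⟩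
      twSeq ℓ (oplus τ κm κp) i    ≡⟨ twSeq-oplus-κ (partition⇒antitone pτ) (wide-I M Iτ) i ⟩
      twSeq ℓ τ i + κ̂ i            ∎)
      where open ≡-Reasoning

    module Preimage (M : ℕ) (L≤M : LBound κm κp lam ω ℚ.≤ (+ M) ℚ./ 1) (ρ : List ℕ) (Iρ : I (suc M) ρ) where

      open BoundedBy (LBound≤⇒BoundedBy κm κp lam ω _ L≤M)

      pρ : IsPartition ρ
      pρ = proj₁ Iρ

      aρ : Antitone ρ
      aρ = partition⇒antitone pρ

      r : ℕ → ℕ
      r = twSeq ℓ ρ

      P : ℕ → ℕ
      P = psum r

      above : ∀ n → L n + suc M * K n ≤ P n
      above n = subst (_≤ P n) (psum-A (suc M) n) (proj₂ (proj₁ (proj₂ (proj₂ Iρ))) n)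

      below : ∀ n → P n ≤ W n + suc M * K n
      below n = subst (P n ≤_) (psum-B (suc M) n) (proj₂ (proj₂ (proj₂ (proj₂ Iρ))) n)

      aboveℤ : ∀ n → + L n ℤ.+ (+ 1 ℤ.+ + M) ℤ.* + K n ℤ.≤ + P n
      aboveℤ n = subst (ℤ._≤ + P n) (cong (ℤ._+_ (+ L n)) (ℤP.pos-* (suc M) (K n))) (+≤+ (above n))

      belowℤ : ∀ n → + P n ℤ.≤ + W n ℤ.+ (+ 1 ℤ.+ + M) ℤ.* + K n
      belowℤ n = subst (ℤ._≤_ (+ P n)) (cong (ℤ._+_ (+ W n)) (ℤP.pos-* (suc M) (K n))) (+≤+ (below n))

      κ̂-< : ∀ {j} → j < ℓ → κ̂ j ≡ at κm j
      κ̂-< = twPair-< ℓ κm κp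

      minus-step : ∀ j → suc j < ℓ → r (suc j) + κ̂ j ≤ r j + κ̂ (suc j)
      minus-step j 1+j<ℓ with κ̂ (suc j) ℕ.<? κ̂ j
      ... | no  κ̂ⱼ≤κ̂ⱼ₊₁ = +-mono-≤ (subst₂ _≤_ (sym (twSeq-< ℓ ρ 1+j<ℓ)) (sym (twSeq-< ℓ ρ (<⇒≤ 1+j<ℓ)))
                                              (countGE-antitone ρ (n≤1+n (suc j))))
                                    (≮⇒≥ κ̂ⱼ≤κ̂ⱼ₊₁)
      ... | yes κ̂ⱼ₊₁<κ̂ⱼ = ℤP.drop‿+≤+ (step-from-bounds
                (+ P j) (+ r j) (+ r (suc j)) (+ L (suc j)) (+ W j) (+ twSeq ℓ ω j) (+ twSeq ℓ ω (suc j))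
                (+ K j) (+ κ̂ j) (+ κ̂ (suc j)) (+ M) (belowℤ (suc (suc j))) (belowℤ j) (aboveℤ (suc j)) Lⱼ₊₁≤M)
        where
        j<ℓ = <⇒≤ 1+j<ℓ
        Lⱼ₊₁≤M : Lnum (+ W j) (+ twSeq ℓ ω j) (+ twSeq ℓ ω (suc j)) (+ L (suc j))
                 ℤ.≤ + M ℤ.* (+ κ̂ j ℤ.- + κ̂ (suc j))
        Lⱼ₊₁≤M = subst₂ ℤ._≤_
          (Lnum-cong (S-decMinus ℓ ω (<⇒≤ j<ℓ)) (cong +_ (at-decMinus ℓ ω j<ℓ)) (cong +_ (at-decMinus ℓ ω 1+j<ℓ))
                     (S-decMinus ℓ lam (<⇒≤ 1+j<ℓ)))
          (cong (λ x → + M ℤ.* x) (sym (cong₂ (λ a b → + a ℤ.- + b) (κ̂-< j<ℓ) (κ̂-< 1+j<ℓ))))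
          (frac-diff≤⇒≤* M (subst₂ _<_ (κ̂-< 1+j<ℓ) (κ̂-< j<ℓ) κ̂ⱼ₊₁<κ̂ⱼ)
             (ℚP.≤-trans (Lk≤LBox (decMinus ℓ lam) (decMinus ℓ ω) κm j 1+j<ℓ) minus-bound))

      m : ℕ
      m = len (decPlus ℓ lam) ⊔ b

      junction-room : 0 < ℓ → m + κ̂ (ℓ ∸ 1) ≤ r (ℓ ∸ 1)
      junction-room 0<ℓ = ℤP.drop‿+≤+ (junction-from-bounds
        (+ P l) (+ r l) (+ L ℓ) (+ W l) (+ K l) (+ κ̂ l) (+ m) (+ M) low up bound)
        where
        l = ℓ ∸ 1
        l+1≡ℓ = suc[n∸1]≡n 0<ℓ
        l<ℓ = n∸1<n 0<ℓ
        low : + L ℓ ℤ.+ (+ 1 ℤ.+ + M) ℤ.* (+ K l ℤ.+ + κ̂ l) ℤ.≤ + P l ℤ.+ + r l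
        low = subst (λ n → + L n ℤ.+ (+ 1 ℤ.+ + M) ℤ.* + K (suc l) ℤ.≤ + P (suc l)) l+1≡ℓ (aboveℤ (suc l))
        up : + P l ℤ.≤ + W l ℤ.+ (+ 1 ℤ.+ + M) ℤ.* + K l
        up = belowℤ l
        -- |ω⁻| = W ℓ = W l + ω_l and ω⁻_ℓ = ω_l, so the junction bound reads m + W l - L ℓ ≤ M κ̂ l
        bound : + m ℤ.+ + W l ℤ.- + L ℓ ℤ.≤ + M ℤ.* + κ̂ l
        bound = subst₂ ℤ._≤_
          (begin
            + m ℤ.+ + size (decMinus ℓ ω) ℤ.- + size (decMinus ℓ lam) ℤ.- + part (decMinus ℓ ω) ℓ
              ≡⟨ cong₂ (λ a c → + m ℤ.+ + a ℤ.- + size (decMinus ℓ lam) ℤ.- + c)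
                       (trans (size-decMinus ℓ ω) (cong W (sym l+1≡ℓ)))
                       (trans (cong (part (decMinus ℓ ω)) (sym l+1≡ℓ)) (at-decMinus ℓ ω l<ℓ)) ⟩
            + m ℤ.+ (+ W l ℤ.+ + twSeq ℓ ω l) ℤ.- + size (decMinus ℓ lam) ℤ.- + twSeq ℓ ω l
              ≡⟨ cancel (+ m) (+ W l) (+ twSeq ℓ ω l) (+ size (decMinus ℓ lam)) ⟩
            + m ℤ.+ + W l ℤ.- + size (decMinus ℓ lam)
              ≡⟨ cong (λ a → + m ℤ.+ + W l ℤ.- + a) (size-decMinus ℓ lam) ⟩
            + m ℤ.+ + W l ℤ.- + L ℓ ∎)
          (cong (λ x → + M ℤ.* + x) (trans (cong (part κm) (sym l+1≡ℓ)) (sym (κ̂-< l<ℓ))))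
          (frac≤⇒≤* _ (part κm ℓ) M 0<κₗ (junction-bound (λ ℓ≡0 → <⇒≢ 0<ℓ (sym ℓ≡0))))
          where
          open ≡-Reasoning
          cancel : ∀ (m w x s : ℤ) → m ℤ.+ (w ℤ.+ x) ℤ.- s ℤ.- x ≡ m ℤ.+ w ℤ.- s
          cancel = ZSolver.solve-∀
          0<κₗ : 0 < part κm ℓ
          0<κₗ = subst (0 <_) (cong (part κm) l+1≡ℓ)
                   (at-<length⇒0< (proj₂ pκm) (subst (l <_) (len≡length (proj₂ pκm)) l<ℓ))


      λ⁺ ω⁺ : List ℕ
      λ⁺ = decPlus ℓ lam
      ω⁺ = decPlus ℓ ω

      -- the shift c = |λ⁺| - |ω⁺| in term (2) of L is W ℓ - L ℓ, because |λ| = |ω|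
      c≡W-L : + size λ⁺ ℤ.- + size ω⁺ ≡ + W ℓ ℤ.- + L ℓ
      c≡W-L = +≡+⇒-≡- (+ L ℓ) (+ size λ⁺) (+ W ℓ) (+ size ω⁺) (cong +_ (begin
        L ℓ + size λ⁺      ≡⟨ cong (_+ size λ⁺) (sym (size-decMinus ℓ lam)) ⟩
        size (decMinus ℓ lam) + size λ⁺ ≡⟨ sym (size-decompose aλ ℓ) ⟩
        size lam           ≡⟨ proj₁ lam⊴ω ⟩
        size ω             ≡⟨ size-decompose aω ℓ ⟩
        size (decMinus ℓ ω) + size ω⁺ ≡⟨ cong (_+ size ω⁺) (size-decMinus ℓ ω) ⟩
        W ℓ + size ω⁺      ∎))
        where open ≡-Reasoning

      first-row-L-bound : at κp 1 < at κp 0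
        → Lnum (+ W ℓ) (+ twSeq ℓ ω ℓ) (+ twSeq ℓ ω (suc ℓ)) (+ L (suc ℓ)) ℤ.≤ + M ℤ.* (+ at κp 0 ℤ.- + at κp 1)
      first-row-L-bound κ₁<κ₀ =
        subst (ℤ._≤ _) numerator (frac-diff≤⇒≤* M κ₁<κ₀ (first-row-bound λ κ₀≡κ₁ → <⇒≢ κ₁<κ₀ (sym κ₀≡κ₁)))
        where
        a = + twSeq ℓ ω ℓ
        a′ = + twSeq ℓ ω (suc ℓ)
        x = + twSeq ℓ lam ℓ
        regroup : ∀ (a a′ x s o w l : ℤ) → a ℤ.+ a′ ℤ.- (+ 2) ℤ.* x ℤ.+ (+ 2) ℤ.* s ℤ.- (+ 2) ℤ.* o
                ≡ (+ 2) ℤ.* w ℤ.+ a ℤ.+ a′ ℤ.- (+ 2) ℤ.* (l ℤ.+ x) ℤ.+ (+ 2) ℤ.* ((s ℤ.- o) ℤ.- (w ℤ.- l))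
        regroup = ZSolver.solve-∀
        ω⁺₁≡a : toZ ω⁺ 1 ≡ a
        ω⁺₁≡a = cong +_ (trans (at-decPlus≡twSeq aω ℓ 0) (cong (twSeq ℓ ω) (+-identityʳ ℓ)))
        ω⁺₂≡a′ : toZ ω⁺ 2 ≡ a′
        ω⁺₂≡a′ = cong +_ (trans (at-decPlus≡twSeq aω ℓ 1) (cong (twSeq ℓ ω) (+-comm ℓ 1)))
        λ⁺₁≡x : toZ λ⁺ 1 ≡ x
        λ⁺₁≡x = cong +_ (trans (at-decPlus≡twSeq aλ ℓ 0) (cong (twSeq ℓ lam) (+-identityʳ ℓ)))
        term₃ : ℤ → ℤ → ℤ → ℤ
        term₃ u v y = u ℤ.+ v ℤ.- (+ 2) ℤ.* y ℤ.+ (+ 2) ℤ.* (+ size λ⁺) ℤ.- (+ 2) ℤ.* (+ size ω⁺)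
        numerator : term₃ (toZ ω⁺ 1) (toZ ω⁺ 2) (toZ λ⁺ 1) ≡ Lnum (+ W ℓ) a a′ (+ L (suc ℓ))
        numerator = begin
          term₃ (toZ ω⁺ 1) (toZ ω⁺ 2) (toZ λ⁺ 1)
            ≡⟨ cong₂ (λ u v → term₃ u v (toZ λ⁺ 1)) ω⁺₁≡a ω⁺₂≡a′ ⟩
          term₃ a a′ (toZ λ⁺ 1)
            ≡⟨ cong (term₃ a a′) λ⁺₁≡x ⟩
          term₃ a a′ x
            ≡⟨ regroup a a′ x (+ size λ⁺) (+ size ω⁺) (+ W ℓ) (+ L ℓ) ⟩
          Lnum (+ W ℓ) a a′ (+ L (suc ℓ)) ℤ.+ (+ 2) ℤ.* ((+ size λ⁺ ℤ.- + size ω⁺) ℤ.- (+ W ℓ ℤ.- + L ℓ))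
            ≡⟨ cong (λ y → Lnum (+ W ℓ) a a′ (+ L (suc ℓ)) ℤ.+ (+ 2) ℤ.* (y ℤ.- (+ W ℓ ℤ.- + L ℓ))) c≡W-L ⟩
          Lnum (+ W ℓ) a a′ (+ L (suc ℓ)) ℤ.+ (+ 2) ℤ.* ((+ W ℓ ℤ.- + L ℓ) ℤ.- (+ W ℓ ℤ.- + L ℓ))
            ≡⟨ cong (λ y → Lnum (+ W ℓ) a a′ (+ L (suc ℓ)) ℤ.+ (+ 2) ℤ.* y) (ℤP.+-inverseʳ (+ W ℓ ℤ.- + L ℓ)) ⟩
          Lnum (+ W ℓ) a a′ (+ L (suc ℓ)) ℤ.+ (+ 2) ℤ.* + 0
            ≡⟨ ℤP.+-identityʳ _ ⟩
          Lnum (+ W ℓ) a a′ (+ L (suc ℓ)) ∎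
          where open ≡-Reasoning

      later-row-L-bound : ∀ t′ → let t = suc t′ in at κp (suc t) < at κp t
        → Lnum (+ W (ℓ + t)) (+ twSeq ℓ ω (ℓ + t)) (+ twSeq ℓ ω (suc (ℓ + t))) (+ L (suc (ℓ + t)))
          ℤ.≤ + M ℤ.* (+ at κp t ℤ.- + at κp (suc t))
      later-row-L-bound t′ κₜ₊₁<κₜ =
        subst (ℤ._≤ _) numerator (frac-diff≤⇒≤* M κₜ₊₁<κₜ
          (ℚP.≤-trans (Lk≤LDom (toZ λ⁺) shifted κp (suc t) (s≤s z≤n) (κp-support t (≤-<-trans z≤n κₜ₊₁<κₜ)))
                      plus-bound))
        where
        t = suc t′
        X = psum (λ u → twSeq ℓ ω (ℓ + u)) t
        Y = psum (λ u → twSeq ℓ lam (ℓ + u)) (suc t)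
        a = + twSeq ℓ ω (ℓ + t)
        a′ = + twSeq ℓ ω (suc (ℓ + t))
        regroup : ∀ (x a a′ y w l : ℤ) → (+ 2) ℤ.* (x ℤ.+ (w ℤ.- l)) ℤ.+ a ℤ.+ a′ ℤ.- (+ 2) ℤ.* y
                                      ≡ (+ 2) ℤ.* (w ℤ.+ x) ℤ.+ a ℤ.+ a′ ℤ.- (+ 2) ℤ.* (l ℤ.+ y)
        regroup = ZSolver.solve-∀
        numerator : Lnum (S shifted t) (shifted (suc t)) (shifted (suc (suc t))) (S (toZ λ⁺) (suc t))
                  ≡ Lnum (+ W (ℓ + t)) a a′ (+ L (suc (ℓ + t)))
        numerator = begin
          Lnum (S shifted t) (shifted (suc t)) (shifted (suc (suc t))) (S (toZ λ⁺) (suc t))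
            ≡⟨ Lnum-cong (trans (S-shift-first shifted (toZ ω⁺) _ shifted-1 shifted-2+ t′) (cong₂ ℤ._+_ (S-decPlus aω ℓ t) c≡W-L))
                         (trans (shifted-2+ t′) (cong +_ (at-decPlus≡twSeq aω ℓ t)))
                         (trans (shifted-2+ t) (cong +_ (trans (at-decPlus≡twSeq aω ℓ (suc t)) (cong (twSeq ℓ ω) (+-suc ℓ t)))))
                         (S-decPlus aλ ℓ (suc t)) ⟩
          Lnum (+ X ℤ.+ (+ W ℓ ℤ.- + L ℓ)) a a′ (+ Y)
            ≡⟨ regroup (+ X) a a′ (+ Y) (+ W ℓ) (+ L ℓ) ⟩
          (+ 2) ℤ.* + (W ℓ + X) ℤ.+ a ℤ.+ a′ ℤ.- (+ 2) ℤ.* + (L ℓ + Y)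
            ≡⟨ cong₂ (λ w l → (+ 2) ℤ.* + w ℤ.+ a ℤ.+ a′ ℤ.- (+ 2) ℤ.* + l)
                     (sym (psum-split (twSeq ℓ ω) ℓ t))
                     (trans (sym (psum-split (twSeq ℓ lam) ℓ (suc t))) (cong L (+-suc ℓ t))) ⟩
          Lnum (+ W (ℓ + t)) a a′ (+ L (suc (ℓ + t))) ∎
          where open ≡-Reasoning

      plus-L-bound : ∀ t → at κp (suc t) < at κp t
        → Lnum (+ W (ℓ + t)) (+ twSeq ℓ ω (ℓ + t)) (+ twSeq ℓ ω (suc (ℓ + t))) (+ L (suc (ℓ + t)))
          ℤ.≤ + M ℤ.* (+ at κp t ℤ.- + at κp (suc t))
      plus-L-bound zero    = subst (λ i → _ → Lnum (+ W i) (+ twSeq ℓ ω i) (+ twSeq ℓ ω (suc i)) (+ L (suc i)) ℤ.≤ _)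
                                   (sym (+-identityʳ ℓ)) first-row-L-bound
      plus-L-bound (suc t′) = later-row-L-bound t′

      plus-step : ∀ t → r (suc (ℓ + t)) + κ̂ (ℓ + t) ≤ r (ℓ + t) + κ̂ (suc (ℓ + t))
      plus-step t with κ̂ (suc (ℓ + t)) ℕ.<? κ̂ (ℓ + t)
      ... | no  κ̂ᵢ≤κ̂ᵢ₊₁ = +-mono-≤ r-anti (≮⇒≥ κ̂ᵢ≤κ̂ᵢ₊₁)
        where
        r-anti : r (suc (ℓ + t)) ≤ r (ℓ + t)
        r-anti = subst₂ _≤_ (trans (sym (twSeq-+ aρ ℓ (suc t))) (cong r (+-suc ℓ t))) (sym (twSeq-+ aρ ℓ t))
                            (∸-monoˡ-≤ ℓ (antitone aρ t))
      ... | yes κ̂ᵢ₊₁<κ̂ᵢ = ℤP.drop‿+≤+ (step-from-bounds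
                (+ P i) (+ r i) (+ r (suc i)) (+ L (suc i)) (+ W i) (+ twSeq ℓ ω i) (+ twSeq ℓ ω (suc i))
                (+ K i) (+ κ̂ i) (+ κ̂ (suc i)) (+ M) (belowℤ (suc (suc i))) (belowℤ i) (aboveℤ (suc i)) bound)
        where
        i = ℓ + t
        κ̂ᵢ₊₁ : κ̂ (suc i) ≡ at κp (suc t)
        κ̂ᵢ₊₁ = trans (cong κ̂ (sym (+-suc ℓ t))) (κ̂-+ (suc t))
        numerator = Lnum (+ W i) (+ twSeq ℓ ω i) (+ twSeq ℓ ω (suc i)) (+ L (suc i))
        bound : numerator ℤ.≤ + M ℤ.* (+ κ̂ i ℤ.- + κ̂ (suc i))
        bound = subst₂ (λ x y → numerator ℤ.≤ + M ℤ.* (+ x ℤ.- + y)) (sym (κ̂-+ t)) (sym κ̂ᵢ₊₁)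
                       (plus-L-bound t (subst₂ _<_ κ̂ᵢ₊₁ (κ̂-+ t) κ̂ᵢ₊₁<κ̂ᵢ))

      plus-finite : ∀ t → m ≤ t → r (ℓ + t) ≡ 0
      plus-finite t m≤t = psum-at-bound r (size ρ) (ℓ + m) (psum-twSeq-≤-size aρ ℓ) |ρ|≤Pℓ+m (+-monoʳ-≤ ℓ m≤t)
        where
        A-ends : ∀ {i} → ℓ + m ≤ i → twSeq ℓ (A (suc M)) i ≡ 0
        A-ends {i} ℓ+m≤i = begin
          twSeq ℓ (A (suc M)) i                 ≡⟨ twSeq-oplusM aλ wideλ (suc M) i ⟩
          twSeq ℓ lam i + suc M * κ̂ i           ≡⟨ cong₂ (λ x y → x + suc M * y) λ⁺-ends κ̂-ends ⟩
          0 + suc M * 0                         ≡⟨ *-zeroʳ (suc M) ⟩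
          0                                     ∎
          where
          open ≡-Reasoning
          u = i ∸ ℓ
          ℓ+u≡i = m+[n∸m]≡n (≤-trans (m≤m+n ℓ m) ℓ+m≤i)
          m≤u : m ≤ u
          m≤u = subst (_≤ u) (m+n∸m≡n ℓ m) (∸-monoˡ-≤ ℓ ℓ+m≤i)
          λ⁺-ends : twSeq ℓ lam i ≡ 0
          λ⁺-ends = trans (cong (twSeq ℓ lam) (sym ℓ+u≡i)) (trans (sym (at-decPlus≡twSeq aλ ℓ u))
                      (at-≥length λ⁺ (≤-trans (≤-trans (≤-reflexive (sym (len-decPlus ℓ lam))) (m≤m⊔n _ b)) m≤u)))
          κ̂-ends : κ̂ i ≡ 0
          κ̂-ends = trans (cong κ̂ (sym ℓ+u≡i)) (trans (κ̂-+ u) (κp-short u (≤-trans (m≤n⊔m (len λ⁺) b) m≤u)))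
        |ρ|≤Pℓ+m : size ρ ≤ P (ℓ + m)
        |ρ|≤Pℓ+m = begin
          size ρ                            ≡⟨ proj₁ (proj₂ Iρ) ⟩
          size (A (suc M))                  ≡⟨ size≡psum-twSeq (aA (suc M)) ℓ (m≤n+m (ℓ + length (A (suc M))) (ℓ + m)) ⟩
          psum (twSeq ℓ (A (suc M))) (ℓ + m + (ℓ + length (A (suc M))))
                                            ≡⟨ psum-stable _ (ℓ + m) A-ends (m≤m+n _ _) ⟩
          psum (twSeq ℓ (A (suc M))) (ℓ + m) ≤⟨ proj₂ (proj₁ (proj₂ (proj₂ Iρ))) (ℓ + m) ⟩
          P (ℓ + m)                         ∎
          where open ≤-Reasoning

      κ̂≤r : ∀ i → κ̂ i ≤ r i
      κ̂≤r = split-at ℓ minus-block plus-block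
        where
        minus-block : ∀ {i} → i < ℓ → κ̂ i ≤ r i
        minus-block {i} i<ℓ = ≤-downwards r κ̂ (ℓ ∸ 1)
          (≤-trans (m≤n+m _ m) (junction-room (≤-<-trans z≤n i<ℓ)))
          (λ k k<ℓ-1 → minus-step k (subst (suc k <_) (suc[n∸1]≡n (≤-<-trans z≤n i<ℓ)) (s≤s k<ℓ-1)))
          i (<⇒≤∸1 i<ℓ)
        plus-block : ∀ {i} → ℓ ≤ i → κ̂ i ≤ r i
        plus-block {i} ℓ≤i = subst (λ j → κ̂ j ≤ r j) (m+[n∸m]≡n ℓ≤i) (plus-block-+ (i ∸ ℓ))
          where
          plus-block-+ : ∀ t → κ̂ (ℓ + t) ≤ r (ℓ + t)
          plus-block-+ t with t ℕ.<? b
          ... | no  t≮b = subst (_≤ r (ℓ + t)) (sym (trans (κ̂-+ t) (κp-short t (≮⇒≥ t≮b)))) z≤n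
          ... | yes t<b = ≤-downwards (λ t → r (ℓ + t)) (λ t → κ̂ (ℓ + t)) b
            (subst (_≤ r (ℓ + b)) (sym (trans (κ̂-+ b) (κp-short b ≤-refl))) z≤n)
            (λ k _ → subst (λ j → r j + κ̂ (ℓ + k) ≤ r (ℓ + k) + κ̂ j) (sym (+-suc ℓ k)) (plus-step k))
            t (<⇒≤ t<b)

      d : ℕ → ℕ
      d i = r i ∸ κ̂ i

      d-plus-finite : ∀ t → m ≤ t → d (ℓ + t) ≡ 0
      d-plus-finite t m≤t = trans (cong (_∸ κ̂ (ℓ + t)) (plus-finite t m≤t)) (0∸n≡0 (κ̂ (ℓ + t)))

      open Realise ℓ d m
        (λ j 1+j<ℓ → ∸-descend (minus-step j 1+j<ℓ) (κ̂≤r (suc j)))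
        (λ t → ∸-descend (subst (λ j → r j + κ̂ (ℓ + t) ≤ r (ℓ + t) + κ̂ j) (sym (+-suc ℓ t)) (plus-step t))
                         (κ̂≤r (ℓ + suc t)))
        (λ 0<ℓ t 0<dₜ → ≤-trans (≰⇒> λ m≤t → <⇒≢ 0<dₜ (sym (d-plus-finite t m≤t)))
                                (m+n≤o⇒m≤o∸n m (junction-room 0<ℓ)))
        d-plus-finite

      r≡twSeq-σ+κ̂ : ∀ i → r i ≡ twSeq ℓ σ i + 1 * κ̂ i
      r≡twSeq-σ+κ̂ i = trans (sym (m∸n+n≡m (κ̂≤r i))) (cong₂ _+_ (sym (twSeq-σ i)) (sym (*-identityˡ (κ̂ i))))

      size-ρ : size ρ ≡ size σ + |κ̂|
      size-ρ = trans (size-via-twSeq 1 aρ σ-antitone r≡twSeq-σ+κ̂) (cong (_+_ (size σ)) (*-identityˡ |κ̂|))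

      psum-ρ : ∀ n → P n ≡ psum (twSeq ℓ σ) n + K n
      psum-ρ n = trans (psum-+* 1 r≡twSeq-σ+κ̂ n) (cong (_+_ (psum (twSeq ℓ σ) n)) (*-identityˡ (K n)))

      σ∈I : I M σ
      σ∈I = σ-isPartition , |σ|≡|A| , (sym |σ|≡|A| , A⊴σ) , (|σ|≡|B| , σ⊴B)
        where
        |σ|≡|A| : size σ ≡ size (A M)
        |σ|≡|A| = +-cancelʳ-≡ |κ̂| _ _ (begin
          size σ + |κ̂|              ≡⟨ sym size-ρ ⟩
          size ρ                    ≡⟨ trans (proj₁ (proj₂ Iρ)) (size-A (suc M)) ⟩
          size lam + suc M * |κ̂|    ≡⟨ sym (+-*-suc (size lam) M |κ̂|) ⟩
          size lam + M * |κ̂| + |κ̂|  ≡⟨ cong (_+ |κ̂|) (sym (size-A M)) ⟩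
          size (A M) + |κ̂|          ∎)
          where open ≡-Reasoning
        |σ|≡|B| : size σ ≡ size (B M)
        |σ|≡|B| = +-cancelʳ-≡ |κ̂| _ _ (begin
          size σ + |κ̂|              ≡⟨ sym size-ρ ⟩
          size ρ                    ≡⟨ trans (proj₁ (proj₂ (proj₂ (proj₂ Iρ)))) (size-B (suc M)) ⟩
          size ω + suc M * |κ̂|      ≡⟨ sym (+-*-suc (size ω) M |κ̂|) ⟩
          size ω + M * |κ̂| + |κ̂|    ≡⟨ cong (_+ |κ̂|) (sym (size-B M)) ⟩
          size (B M) + |κ̂|          ∎)
          where open ≡-Reasoning
        A⊴σ : ∀ n → psum (twSeq ℓ (A M)) n ≤ psum (twSeq ℓ σ) n
        A⊴σ n = +-cancelʳ-≤ (K n) _ _ (begin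
          psum (twSeq ℓ (A M)) n + K n  ≡⟨ cong (_+ K n) (psum-A M n) ⟩
          L n + M * K n + K n           ≡⟨ +-*-suc (L n) M (K n) ⟩
          L n + suc M * K n             ≤⟨ above n ⟩
          P n                           ≡⟨ psum-ρ n ⟩
          psum (twSeq ℓ σ) n + K n      ∎)
          where open ≤-Reasoning
        σ⊴B : ∀ n → psum (twSeq ℓ σ) n ≤ psum (twSeq ℓ (B M)) n
        σ⊴B n = +-cancelʳ-≤ (K n) _ _ (begin
          psum (twSeq ℓ σ) n + K n      ≡⟨ sym (psum-ρ n) ⟩
          P n                           ≤⟨ below n ⟩
          W n + suc M * K n             ≡⟨ sym (+-*-suc (W n) M (K n)) ⟩
          W n + M * K n + K n           ≡⟨ cong (_+ K n) (sym (psum-B M n)) ⟩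
          psum (twSeq ℓ (B M)) n + K n  ∎)
          where open ≤-Reasoning

      preimage : ∃ λ σ → I M σ × oplus σ κm κp ≡ ρ
      preimage = σ , σ∈I , oplus-σ≡ρ
        where
        oplus-σ≡ρ : oplus σ κm κp ≡ ρ
        oplus-σ≡ρ = twSeq-injective ℓ (oplus-isPartition σ κm κp) pρ λ i →
          trans (twSeq-oplus-κ σ-antitone (wide-I M σ∈I) i)
                (sym (trans (r≡twSeq-σ+κ̂ i) (cong (_+_ (twSeq ℓ σ i)) (*-identityˡ (κ̂ i)))))

proposition9p10 : (κm κp lam ω : List ℕ)
    → IsPartition κm → IsPartition κp → IsPartition lam → IsPartition ω
    → Large (suc (len κm)) (len κp) ω
    → TwLeq (len κm) lam ω
    → (M : ℕ)
    → ((σ : List ℕ)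
         → InTwInterval (len κm) (oplusM lam M κm κp) (oplusM ω M κm κp) σ
         → InTwInterval (len κm) (oplusM lam (suc M) κm κp) (oplusM ω (suc M) κm κp) (oplus σ κm κp))
      × ((σ τ : List ℕ)
         → InTwInterval (len κm) (oplusM lam M κm κp) (oplusM ω M κm κp) σ
         → InTwInterval (len κm) (oplusM lam M κm κp) (oplusM ω M κm κp) τ
         → oplus σ κm κp ≡ oplus τ κm κp → σ ≡ τ)
      × (LBound κm κp lam ω ℚ.≤ (+ M) ℚ./ 1
         → (ρ : List ℕ)
         → InTwInterval (len κm) (oplusM lam (suc M) κm κp) (oplusM ω (suc M) κm κp) ρ
         → ∃ λ σ → InTwInterval (len κm) (oplusM lam M κm κp) (oplusM ω M κm κp) σ
                   × oplus σ κm κp ≡ ρ)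
proposition9p10 κm κp lam ω pκm pκp plam pω large lam⊴ω M =
  oplus-maps-I M , oplus-injective-I M , λ L≤M ρ Iρ → Preimage.preimage M L≤M ρ Iρ
  where
  open Shift κm κp pκm pκp
  aω = partition⇒antitone pω
  open Interval lam ω plam pω (large⇒wide aω large) (large⇒full aω large) lam⊴ω
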